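{- Let $\mathbf{N}(P,E)$ be a ported extensor, let $\epsilon$ be a ground set orientation, write $\mathbf{M}^\epsilon_E$ for $\mathbf{M}_E$ defined using $\epsilon$, and let $Q$ be a sequence of distinct elements of $P_\iota\sqcup P_\upsilon$ with $|Q|=|P|$. (1) $\mathbf{M}^\epsilon_E(\pm\mathbf{N})[Q]$ is unchanged when $\mathbf{N}$ is replaced by $-\mathbf{N}$, and is alternating in $E$, in $\epsilon$ and in $Q$. (2) $\epsilon(PE)\,\mathbf{M}^\epsilon_E(\pm\mathbf{N})[Q]$ is unchanged when $\mathbf{N}$ is replaced by $-\mathbf{N}$ and under changes of $\epsilon$ or reorderings of $E$; it is alternating in $P$ and in $Q$. (3) If $P$ is independent in the matroid presented by $\mathbf{N}$, then $\epsilon(PE)\,\mathbf{M}^\epsilon_E(\pm\mathbf{N})[P_\iota]=\sum_{B\subseteq E}g_B\,r_{E\setminus B}\,\mathbf{N}[BP]^2$. (4) If $P$ is coindependent in the matroid presented by $\mathbf{N}$ (i.e. $E$ contains a basis), then $\epsilon(PE)\,\mathbf{M}^\epsilon_E(\pm\mathbf{N})[P_\upsilon]=\sum_{B\subseteq E}g_B\,r_{E\setminus B}\,\mathbf{N}[B]^2$.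
   Context: $K$ is a field, extended if necessary by parameters $g_e,r_e$; $g_B=\prod_{e\in B}g_e$. For a finite set $S$, $\mathcal{E}(KS)$ is the exterior algebra over $KS$ with basis $S$; for a sequence $A$ of distinct elements, $\mathbf{A}$ is the product of their images in order. Set symbols denote sequences in an arbitrary order; $AB$ is concatenation; $\bar X$ is the complement in the ground set. An extensor with ground set $S$ is an element of $\mathcal{E}(KS)$ that is a scalar multiple of $\mathbf{1}$ or an exterior product of vectors; its Plücker coordinates are the alternating function $\mathbf{N}[A]$ with $\mathbf{N}=\sum_A\mathbf{N}[A]\mathbf{A}$; the sets $B$ with $\mathbf{N}[B]\neq0$ are the bases of the matroid presented by $\mathbf{N}$. Contraction: $(\mathbf{N}/e)[B]=\mathbf{N}[Be]$; $\mathbf{N}/X=\mathbf{N}/x_k/\cdots/x_1$ for $X=x_1\cdots x_k$. A ground set orientation $\epsilon$ is an alternating function on finite sequences of ground set elements into $\{1,-1,0\}$, nonzero on sequences of distinct elements, $\epsilon(\emptyset)=1$; canonical dual $\mathbf{N}^\perp[X]=\mathbf{N}[\bar X]\epsilon(\bar X X)$. A ported extensor $\mathbf{N}(P,E)$ is an extensor with ground set $P\sqcup E$. $P_\iota,P_\upsilon$ are disjoint copies of $P$ with $P_\iota,P_\upsilon$ also denoting the copies of the sequence $P$. $\iota_g,\upsilon_r$ are the algebra homomorphisms $\mathcal{E}(K(P\sqcup E))\to\mathcal{E}(K(P_\iota\sqcup P_\upsilon\sqcup E))$ induced by $\mathbf{e}\mapsto g_e\mathbf{e},\ \mathbf{p}\mapsto\mathbf{p}_\iota$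 and $\mathbf{e}\mapsto r_e\mathbf{e},\ \mathbf{p}\mapsto\mathbf{p}_\upsilon$. $\mathbf{M}(\mathbf{N})=\iota_g(\mathbf{N})\upsilon_r(\mathbf{N}^\perp)$ and, with $E$ a fixed sequence, $\mathbf{M}_E(\mathbf{N})=\mathbf{M}(\mathbf{N})/E$. A quantity $F^\epsilon(X)$ depending on $\epsilon$ and a sequence $X$ is alternating in $X$ if $F^\epsilon(X_\sigma)=\mathrm{sgn}(\sigma)F^\epsilon(X)$ for all permutations $\sigma$, and alternating in $\epsilon$ if $F^{ -\epsilon}(X)=-F^\epsilon(X)$. -}

module Defs where

open import Level using (Level; _⊔_; suc)
open import Algebra.Bundles using (CommutativeRing)
open import Data.Bool using (Bool; true; false; if_then_else_; _∧_)
open import Data.Nat using (ℕ)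
open import Data.Fin using (Fin) renaming (_<?_ to _<ᶠ?_; _≟_ to _≟ᶠ_)
open import Data.Fin.Permutation using (Permutation′; _⟨$⟩ʳ_)
open import Data.List using (List; []; _∷_; _++_; map; foldr; length; tabulate; lookup; allFin; concatMap; filter)
open import Data.List.Membership.Propositional using (_∈_)
open import Data.List.Relation.Unary.Unique.Propositional using (Unique)
open import Data.Maybe using (Maybe; just; nothing; maybe)
open import Data.Product using (Σ; ∃; _×_; _,_)
open import Data.Sum using (_⊎_; inj₁; inj₂)
import Data.Sum.Properties as SumP
import Data.List.Membership.DecPropositional as DecMem
open import Relation.Nullary using (¬_; does; ¬?)
open import Relation.Binary.PropositionalEquality using (_≡_)
open import Relation.Binary.Definitions using (DecidableEquality)

record Field (c ℓ : Level) : Set (suc (c ⊔ ℓ)) where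
  field
    commutativeRing : CommutativeRing c ℓ
  open CommutativeRing commutativeRing public
  field
    0≉1     : ¬ (0# ≈ 1#)
    inverse : ∀ x → ¬ (x ≈ 0#) → Σ Carrier (λ y → x * y ≈ 1#)

data Sgn : Set where
  pos neg nul : Sgn

negˢ : Sgn → Sgn
negˢ pos = neg
negˢ neg = pos
negˢ nul = nul

_·ˢ_ : Sgn → Sgn → Sgn
pos ·ˢ s = s
neg ·ˢ s = negˢ s
nul ·ˢ s = nul

permute : ∀ {a} {A : Set a} (X : List A) → Permutation′ (length X) → List A
permute X σ = tabulate (λ i → lookup X (σ ⟨$⟩ʳ i))

pairs : (n : ℕ) → List (Fin n × Fin n)
pairs n = concatMap (λ i → map (λ j → (i , j)) (allFin n)) (allFin n)

sgnPerm : ∀ {n} → Permutation′ n → Sgn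
sgnPerm {n} σ = foldr step pos (pairs n)
  where
  step : Fin n × Fin n → Sgn → Sgn
  step (i , j) s = if does (i <ᶠ? j) ∧ does ((σ ⟨$⟩ʳ j) <ᶠ? (σ ⟨$⟩ʳ i)) then negˢ s else s

IsOrdering : ∀ {n} → List (Fin n) → Set
IsOrdering {n} X = Unique X × (∀ (i : Fin n) → i ∈ X)

-- Ground sets.  The ported extensor N(P,E) has ground set P ⊔ E, with
-- P = Fin p and E = Fin m.  M(N) lives over P_ι ⊔ P_υ ⊔ E.

G : ℕ → ℕ → Set
G p m = Fin p ⊎ Fin m

_≟G_ : ∀ {p m} → DecidableEquality (G p m)
_≟G_ = SumP.≡-dec _≟ᶠ_ _≟ᶠ_

allG : ∀ p m → List (G p m)
allG p m = map inj₁ (allFin p) ++ map inj₂ (allFin m)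

compl : ∀ {p m} → List (G p m) → List (G p m)
compl {p} {m} X = filter (λ x → ¬? (x ∈? X)) (allG p m)
  where open DecMem _≟G_ using (_∈?_)

data Port (p m : ℕ) : Set where
  ι  : Fin p → Port p m
  υ  : Fin p → Port p m
  el : Fin m → Port p m

Pseq : ∀ {p m} → List (Fin p) → List (G p m)
Pseq = map inj₁

Eseq : ∀ {p m} → List (Fin m) → List (G p m)
Eseq = map inj₂

subsetsC : ∀ {a} {A : Set a} → List A → List (List A × List A)
subsetsC [] = ([] , []) ∷ []
subsetsC (x ∷ xs) = concatMap (λ { (B , C) → (x ∷ B , C) ∷ (B , x ∷ C) ∷ [] }) (subsetsC xs)

-- Exterior algebra over a field, elements represented by their
-- coordinates: x = Σ_A x[A] A, x[A] given for every sequence A.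

module ExtAlg {c ℓ} (F : Field c ℓ) where
  open Field F

  ⟦_⟧ˢ : Sgn → Carrier
  ⟦ pos ⟧ˢ = 1#
  ⟦ neg ⟧ˢ = - 1#
  ⟦ nul ⟧ˢ = 0#

  sumK : List Carrier → Carrier
  sumK = foldr _+_ 0#

  prodK : List Carrier → Carrier
  prodK = foldr _*_ 1#

  _² : Carrier → Carrier
  x ² = x * x

  Ext : Set → Set c
  Ext S = List S → Carrier

  oneE : ∀ {S} → Ext S
  oneE [] = 1#
  oneE (_ ∷ _) = 0#

  vecE : ∀ {S} → (S → Carrier) → Ext S
  vecE v (a ∷ []) = v a
  vecE v _ = 0#

  -- all ways of splitting A into a subsequence L and complementary
  -- subsequence R, with the sign of the permutation A ↦ L R
  splits : ∀ {S : Set} → List S → List (List S × List S × Sgn)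
  splits [] = ([] , [] , pos) ∷ []
  splits (a ∷ A) = concatMap
    (λ { (L , R , s) → (a ∷ L , R , s) ∷ (L , a ∷ R , (if even (length L) then s else negˢ s)) ∷ [] })
    (splits A)
    where
    even : ℕ → Bool
    even ℕ.zero = true
    even (ℕ.suc ℕ.zero) = false
    even (ℕ.suc (ℕ.suc n)) = even n

  _∧E_ : ∀ {S} → Ext S → Ext S → Ext S
  (x ∧E y) A = sumK (map (λ { (L , R , s) → ⟦ s ⟧ˢ * (x L * y R) }) (splits A))

  negE : ∀ {S} → Ext S → Ext S
  negE x A = - x A

  IsExtensor : ∀ {S} → Ext S → Set (c ⊔ ℓ)
  IsExtensor {S} N = Σ Carrier λ k → Σ (List (S → Carrier)) λ vs →
    ∀ A → N A ≈ k * foldr _∧E_ oneE (map vecE vs) A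

  -- matroid presented by N
  IsBasis : ∀ {S} → Ext S → List S → Set ℓ
  IsBasis N B = Unique B × ¬ (N B ≈ 0#)

  Independent : ∀ {S} → Ext S → List S → Set ℓ
  Independent {S} N I = Σ (List S) λ B → IsBasis N B × (∀ x → x ∈ I → x ∈ B)

  Coindependent : ∀ {S} → Ext S → List S → Set ℓ
  Coindependent {S} N I = Σ (List S) λ B → IsBasis N B × (∀ x → x ∈ B → ¬ (x ∈ I))

  module _ {p m : ℕ} where

    dual : (List (G p m) → Sgn) → Ext (G p m) → Ext (G p m)
    dual ε N X = N (compl X) * ⟦ ε (compl X ++ X) ⟧ˢ

    -- preimage of a sequence under ι_g (resp. υ_r) on basis vectors,
    -- with the accumulated scalar factor
    preι : (Fin m → Carrier) → List (Port p m) → Maybe (List (G p m) × Carrier)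
    preι g [] = just ([] , 1#)
    preι g (ι i ∷ A) = Data.Maybe.map (λ { (A' , w) → (inj₁ i ∷ A' , w) }) (preι g A)
    preι g (υ i ∷ A) = nothing
    preι g (el e ∷ A) = Data.Maybe.map (λ { (A' , w) → (inj₂ e ∷ A' , g e * w) }) (preι g A)

    preυ : (Fin m → Carrier) → List (Port p m) → Maybe (List (G p m) × Carrier)
    preυ r [] = just ([] , 1#)
    preυ r (ι i ∷ A) = nothing
    preυ r (υ i ∷ A) = Data.Maybe.map (λ { (A' , w) → (inj₁ i ∷ A' , w) }) (preυ r A)
    preυ r (el e ∷ A) = Data.Maybe.map (λ { (A' , w) → (inj₂ e ∷ A' , r e * w) }) (preυ r A)

    ιmap : (Fin m → Carrier) → Ext (G p m) → Ext (Port p m)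
    ιmap g N A = maybe (λ { (A' , w) → w * N A' }) 0# (preι g A)

    υmap : (Fin m → Carrier) → Ext (G p m) → Ext (Port p m)
    υmap r N A = maybe (λ { (A' , w) → w * N A' }) 0# (preυ r A)

    M : (List (G p m) → Sgn) → (g r : Fin m → Carrier) → Ext (G p m) → Ext (Port p m)
    M ε g r N = ιmap g N ∧E υmap r (dual ε N)

    contract : Ext (Port p m) → List (Port p m) → Ext (Port p m)
    contract N X B = N (B ++ X)

    ME : (List (G p m) → Sgn) → (g r : Fin m → Carrier) → List (Fin m) → Ext (G p m) → Ext (Port p m)
    ME ε g r Es N = contract (M ε g r N) (map el Es)

record Orientation (S : Set) : Set where
  field
    ε      : List S → Sgn
    ε-nil  : ε [] ≡ pos
    ε-alt  : ∀ (X : List S) (σ : Permutation′ (length X)) → ε (permute X σ) ≡ sgnPerm σ ·ˢ ε X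
    ε-dist : ∀ (X : List S) → Unique X → ¬ (ε X ≡ nul)

toPort : ∀ {p m} → Fin p ⊎ Fin p → Port p m
toPort (inj₁ i) = ι i
toPort (inj₂ i) = υ i

module ExtAlg₂ {c ℓ} (F : Field c ℓ) where
  open Field F public
  open ExtAlg F public

  module _ {p m : ℕ} where
    MEQ : (List (G p m) → Sgn) → (g r : Fin m → Carrier) → List (Fin m) → Ext (G p m) → List (Fin p ⊎ Fin p) → Carrier
    MEQ ε g r Es N Q = ME ε g r Es N (map toPort Q)

    WEQ : (List (G p m) → Sgn) → (g r : Fin m → Carrier) → List (Fin p) → List (Fin m) → Ext (G p m) → List (Fin p ⊎ Fin p) → Carrier
    WEQ ε g r Ps Es N Q = ⟦ ε (Pseq Ps ++ Eseq Es) ⟧ˢ * MEQ ε g r Es N Q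

    rhsIndep : (g r : Fin m → Carrier) → List (Fin p) → List (Fin m) → Ext (G p m) → Carrier
    rhsIndep g r Ps Es N = sumK (map (λ { (B , C) → (prodK (map g B) * prodK (map r C)) * (N (Eseq B ++ Pseq Ps)) ² }) (subsetsC Es))

    rhsCoindep : (g r : Fin m → Carrier) → List (Fin m) → Ext (G p m) → Carrier
    rhsCoindep g r Es N = sumK (map (λ { (B , C) → (prodK (map g B) * prodK (map r C)) * (N (Eseq B)) ² }) (subsetsC Es))

{-# OPTIONS --safe #-}
module Submission where

-- Everything rests on alternation. The coordinates of an extensor are alternating, and ι_g, υ_r,
-- the canonical dual and the exterior product preserve alternation, so M^ε_E(N)[Q] is alternating
-- in Q and in E. Replacing N by −N multiplies both factors of M by −1, and replacing ε by another
-- orientation ε′ multiplies the dual by the constant sign ε′(PE)ε(PE), because two orientations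
-- agree up to that sign on every sequence containing all elements; the prefactor ε(PE) in (2)
-- absorbs this constant and the sign of reordering E.
-- For (3) and (4) the exterior product is expanded over the splittings of P_ι E (resp. P_υ E).
-- Since υ_r kills P_ι and ι_g kills P_υ, only the splittings sending P_ι to the left (resp. P_υ to
-- the right) survive, so the sum runs over the subsets B ⊆ E. The term of B is, up to sign,
-- g_B r_{E∖B} N[X] N^⊥[X̄] with X = PB (resp. B), and N^⊥[X̄] = ε(X X̄) N[X]; multiplied by ε(PE)
-- all the signs square away.

open import Defs
open import Data.Nat using (ℕ)
open import Data.Fin using (Fin)
open import Data.Sum using (_⊎_; inj₁; inj₂)
open import Data.List using (List; map; length)
open import Data.List.Relation.Unary.Unique.Propositional using (Unique)
open import Data.Product using (_×_)
open import Relation.Binary.PropositionalEquality using (_≡_)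
open import Function using (_∘_)

open import Data.Bool using (false; if_then_else_; _∧_)
open import Data.Fin as Fin using (zero; suc; toℕ; punchIn)
open import Data.Fin.Permutation
  using (Permutation′; _⟨$⟩ʳ_; _⟨$⟩ˡ_; remove; lift₀; permutation; inverseʳ; punchIn-permute′)
open import Data.Fin.Properties using (toℕ≤pred[n])
open import Data.List using ([]; _∷_; _++_; [_]; foldr; tabulate; lookup; concat; concatMap; allFin)
open import Data.List.Membership.Propositional using (_∈_; _∉_; find)
open import Data.List.Membership.Propositional.Properties
  using (∈-concatMap⁻; ∈-∃++; ∈-++⁺ˡ; ∈-++⁺ʳ; ∈-++⁻; ∈-map⁺; ∈-map⁻; ∈-filter⁺; ∈-filter⁻; ∈-allFin)
open import Data.List.Membership.Propositional.Properties.WithK using (unique∧set⇒bag)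
open import Data.List.Properties
  using ( ++-assoc; ++-identityʳ; map-++; map-∘; length-map; length-++; length-tabulate
        ; tabulate-cong; tabulate-lookup; foldr-++; foldr-map; concatMap-cong; filter-≐ )
open import Data.List.Relation.Binary.BagAndSetEquality using (∼bag⇒↭)
open import Data.List.Relation.Binary.Permutation.Propositional as ↭ using (_↭_; ↭-sym; ↭⇒↭ₛ)
open import Data.List.Relation.Binary.Permutation.Propositional.Properties as ↭ₚ using (∈-resp-↭)
open import Data.List.Relation.Binary.Permutation.Setoid.Properties using (Unique-resp-↭)
import Data.List.Relation.Unary.All as All
open import Data.List.Relation.Unary.All.Properties using (++⁻ˡ; ¬Any⇒All¬)
open import Data.List.Relation.Unary.AllPairs using ([]; _∷_)
open import Data.List.Relation.Unary.Any using (here; there)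
open import Data.List.Relation.Unary.Unique.Propositional.Properties using (++⁺; map⁺; allFin⁺; filter⁺)
open import Data.Maybe using (Maybe; just; nothing)
open import Data.Nat as ℕ using (zero; suc; _≤_; s≤s)
open import Data.Product using (Σ; _,_; proj₁; proj₂)
open import Data.Sum.Properties using (inj₁-injective; inj₂-injective)
open import Function using (id)
open import Function.Bundles using (mk⇔)
open import Relation.Binary.Definitions using (DecidableEquality)
import Relation.Binary.PropositionalEquality as ≡
open import Relation.Binary.PropositionalEquality
  using (_≢_; refl; sym; trans; cong; cong₂; subst; module ≡-Reasoning)
open import Relation.Nullary using (¬_; ¬?; yes; no; does; contradiction)
open import Relation.Unary using (Decidable)

·ˢ-identityʳ : ∀ s → s ·ˢ pos ≡ s
·ˢ-identityʳ pos = refl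
·ˢ-identityʳ neg = refl
·ˢ-identityʳ nul = refl

·ˢ-zeroʳ : ∀ s → s ·ˢ nul ≡ nul
·ˢ-zeroʳ pos = refl
·ˢ-zeroʳ neg = refl
·ˢ-zeroʳ nul = refl

·ˢ-neg : ∀ s → s ·ˢ neg ≡ negˢ s
·ˢ-neg pos = refl
·ˢ-neg neg = refl
·ˢ-neg nul = refl

·ˢ-comm : ∀ s t → s ·ˢ t ≡ t ·ˢ s
·ˢ-comm pos t = sym (·ˢ-identityʳ t)
·ˢ-comm neg t = sym (·ˢ-neg t)
·ˢ-comm nul t = sym (·ˢ-zeroʳ t)

negˢ-involutive : ∀ s → negˢ (negˢ s) ≡ s
negˢ-involutive pos = refl
negˢ-involutive neg = refl
negˢ-involutive nul = refl

negˢ-·ˢ : ∀ s t → negˢ s ·ˢ t ≡ negˢ (s ·ˢ t)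
negˢ-·ˢ pos t = refl
negˢ-·ˢ neg t = sym (negˢ-involutive t)
negˢ-·ˢ nul t = refl

·ˢ-assoc : ∀ s t u → (s ·ˢ t) ·ˢ u ≡ s ·ˢ (t ·ˢ u)
·ˢ-assoc pos t u = refl
·ˢ-assoc neg t u = negˢ-·ˢ t u
·ˢ-assoc nul t u = refl

negˢ-fixed⇒nul : ∀ {s} → s ≡ negˢ s → s ≡ nul
negˢ-fixed⇒nul {pos} ()
negˢ-fixed⇒nul {neg} ()
negˢ-fixed⇒nul {nul} _ = refl

data IsUnit : Sgn → Set where
  pos-unit : IsUnit pos
  neg-unit : IsUnit neg

≢nul⇒IsUnit : ∀ {s} → s ≢ nul → IsUnit s
≢nul⇒IsUnit {pos} _ = pos-unit
≢nul⇒IsUnit {neg} _ = neg-unit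
≢nul⇒IsUnit {nul} s≢nul = contradiction refl s≢nul

IsUnit-·ˢ : ∀ {s t} → IsUnit s → IsUnit t → IsUnit (s ·ˢ t)
IsUnit-·ˢ pos-unit u = u
IsUnit-·ˢ neg-unit pos-unit = neg-unit
IsUnit-·ˢ neg-unit neg-unit = pos-unit

unit-cancelˡ : ∀ {s} → IsUnit s → ∀ t → s ·ˢ (s ·ˢ t) ≡ t
unit-cancelˡ pos-unit t = refl
unit-cancelˡ neg-unit t = negˢ-involutive t

·ˢ-cancelʳ : ∀ {u} → IsUnit u → ∀ s t → s ·ˢ u ≡ t ·ˢ u → s ≡ t
·ˢ-cancelʳ {u} uu s t eq = begin
  s                  ≡⟨ unit-cancelˡ uu s ⟨
  u ·ˢ (u ·ˢ s)      ≡⟨ cong (u ·ˢ_) (trans (·ˢ-comm u s) (trans eq (·ˢ-comm t u))) ⟩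
  u ·ˢ (u ·ˢ t)      ≡⟨ unit-cancelˡ uu t ⟩
  t                  ∎
  where open ≡-Reasoning

parity : ℕ → Sgn
parity zero = pos
parity (suc zero) = neg
parity (suc (suc n)) = parity n

parity-suc : ∀ n → parity (suc n) ≡ negˢ (parity n)
parity-suc zero = refl
parity-suc (suc zero) = refl
parity-suc (suc (suc n)) = parity-suc n

IsUnit-parity : ∀ n → IsUnit (parity n)
IsUnit-parity zero = pos-unit
IsUnit-parity (suc zero) = neg-unit
IsUnit-parity (suc (suc n)) = IsUnit-parity n

-- Signed permutations: xs ↭⟨ s ⟩ ys says that xs is a rearrangement of ys
-- by a permutation of sign s

infix 3 _↭⟨_⟩_

data _↭⟨_⟩_ {A : Set} : List A → Sgn → List A → Set where
  sp-refl  : ∀ {xs} → xs ↭⟨ pos ⟩ xs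
  sp-prep  : ∀ {xs ys s} x → xs ↭⟨ s ⟩ ys → x ∷ xs ↭⟨ s ⟩ x ∷ ys
  sp-swap  : ∀ x y xs → x ∷ y ∷ xs ↭⟨ neg ⟩ y ∷ x ∷ xs
  sp-trans : ∀ {xs ys zs s t} → xs ↭⟨ s ⟩ ys → ys ↭⟨ t ⟩ zs → xs ↭⟨ s ·ˢ t ⟩ zs

module _ {A : Set} where

  sp-subst : ∀ {xs ys : List A} {s t} → s ≡ t → xs ↭⟨ s ⟩ ys → xs ↭⟨ t ⟩ ys
  sp-subst refl p = p

  sp-unit : ∀ {xs ys : List A} {s} → xs ↭⟨ s ⟩ ys → IsUnit s
  sp-unit sp-refl = pos-unit
  sp-unit (sp-prep x p) = sp-unit p
  sp-unit (sp-swap x y xs) = neg-unit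
  sp-unit (sp-trans p q) = IsUnit-·ˢ (sp-unit p) (sp-unit q)

  sp-sym : ∀ {xs ys : List A} {s} → xs ↭⟨ s ⟩ ys → ys ↭⟨ s ⟩ xs
  sp-sym sp-refl = sp-refl
  sp-sym (sp-prep x p) = sp-prep x (sp-sym p)
  sp-sym (sp-swap x y xs) = sp-swap y x xs
  sp-sym (sp-trans {s = s} {t} p q) = sp-subst (·ˢ-comm t s) (sp-trans (sp-sym q) (sp-sym p))

  sp-shift : ∀ (x : A) L R → L ++ x ∷ R ↭⟨ parity (length L) ⟩ x ∷ L ++ R
  sp-shift x [] R = sp-refl
  sp-shift x (y ∷ L) R =
    sp-subst (trans (·ˢ-neg (parity (length L))) (sym (parity-suc (length L))))
      (sp-trans (sp-prep y (sp-shift x L R)) (sp-swap y x (L ++ R)))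

  ↭⇒sp : ∀ {xs ys : List A} → xs ↭ ys → Σ Sgn (xs ↭⟨_⟩ ys)
  ↭⇒sp ↭.refl = pos , sp-refl
  ↭⇒sp (↭.prep x p) = _ , sp-prep x (proj₂ (↭⇒sp p))
  ↭⇒sp (↭.swap x y p) = _ , sp-trans (sp-swap x y _) (sp-prep y (sp-prep x (proj₂ (↭⇒sp p))))
  ↭⇒sp (↭.trans p q) = _ , sp-trans (proj₂ (↭⇒sp p)) (proj₂ (↭⇒sp q))

sp-map : ∀ {A B : Set} (f : A → B) {xs ys s} → xs ↭⟨ s ⟩ ys → map f xs ↭⟨ s ⟩ map f ys
sp-map f sp-refl = sp-refl
sp-map f (sp-prep x p) = sp-prep (f x) (sp-map f p)
sp-map f (sp-swap x y xs) = sp-swap (f x) (f y) (map f xs)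
sp-map f (sp-trans p q) = sp-trans (sp-map f p) (sp-map f q)

insertAt : ∀ {A : Set} → ℕ → A → List A → List A
insertAt zero x L = x ∷ L
insertAt (suc k) x [] = x ∷ []
insertAt (suc k) x (y ∷ L) = y ∷ insertAt k x L

sp-insertAt : ∀ {A : Set} k (x : A) L → k ≤ length L → insertAt k x L ↭⟨ parity k ⟩ x ∷ L
sp-insertAt zero x L _ = sp-refl
sp-insertAt (suc k) x (y ∷ L) (s≤s k≤L) =
  sp-subst (trans (·ˢ-neg (parity k)) (sym (parity-suc k)))
    (sp-trans (sp-prep y (sp-insertAt k x L k≤L)) (sp-swap y x L))

tabulate-insertAt : ∀ {A : Set} {n} (h : Fin (suc n) → A) (k : Fin (suc n)) →
  tabulate h ≡ insertAt (toℕ k) (h k) (tabulate (h ∘ punchIn k))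
tabulate-insertAt h zero = refl
tabulate-insertAt {n = suc n} h (suc k) = cong (h zero ∷_) (tabulate-insertAt (h ∘ suc) k)

-- The sign obtained by moving the preimage of 0 to the front and recursing.
insertionSign : ∀ {n} → Permutation′ n → Sgn
insertionSign {zero} σ = pos
insertionSign {suc n} σ = parity (toℕ (σ ⟨$⟩ˡ zero)) ·ˢ insertionSign (remove (σ ⟨$⟩ˡ zero) σ)

permute-∷ : ∀ {A : Set} (x : A) X (σ : Permutation′ (suc (length X))) →
  permute (x ∷ X) σ ≡ insertAt (toℕ (σ ⟨$⟩ˡ zero)) x (permute X (remove (σ ⟨$⟩ˡ zero) σ))
permute-∷ x X σ = trans (tabulate-insertAt (λ i → lookup (x ∷ X) (σ ⟨$⟩ʳ i)) k)
  (cong₂ (insertAt (toℕ k)) (cong (lookup (x ∷ X)) (inverseʳ σ))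
    (tabulate-cong (λ j → cong (lookup (x ∷ X)) (punchIn-permute′ σ zero j))))
  where k = σ ⟨$⟩ˡ zero

sp-permute : ∀ {A : Set} (X : List A) (σ : Permutation′ (length X)) →
  permute X σ ↭⟨ insertionSign σ ⟩ X
sp-permute [] σ = sp-refl
sp-permute (x ∷ X) σ = subst (_↭⟨ insertionSign σ ⟩ x ∷ X) (sym (permute-∷ x X σ))
  (sp-trans (sp-insertAt (toℕ k) x (permute X τ) k≤X) (sp-prep x (sp-permute X τ)))
  where
  k = σ ⟨$⟩ˡ zero
  τ = remove k σ
  k≤X : toℕ k ≤ length (permute X τ)
  k≤X = subst (toℕ k ≤_) (sym (length-tabulate (λ i → lookup X (τ ⟨$⟩ʳ i)))) (toℕ≤pred[n] k)

foldFin : ∀ n → (Fin n → Sgn → Sgn) → Sgn → Sgn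
foldFin zero f s = s
foldFin (suc n) f s = f zero (foldFin n (f ∘ suc) s)

foldFin-cong : ∀ n {f g : Fin n → Sgn → Sgn} → (∀ i t → f i t ≡ g i t) → ∀ s → foldFin n f s ≡ foldFin n g s
foldFin-cong zero f≗g s = refl
foldFin-cong (suc n) {f} f≗g s = trans (cong (f zero) (foldFin-cong n (f≗g ∘ suc) s)) (f≗g zero _)

foldFin-id : ∀ n {f : Fin n → Sgn → Sgn} → (∀ i t → f i t ≡ t) → ∀ s → foldFin n f s ≡ s
foldFin-id zero f≗id s = refl
foldFin-id (suc n) f≗id s = trans (f≗id zero _) (foldFin-id n (f≗id ∘ suc) s)

foldr-tabulate : ∀ {B : Set} n (f : Fin n → B) (g : B → Sgn → Sgn) s →
  foldr g s (tabulate f) ≡ foldFin n (g ∘ f) s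
foldr-tabulate zero f g s = refl
foldr-tabulate (suc n) f g s = cong (g (f zero)) (foldr-tabulate n (f ∘ suc) g s)

foldr-concatMap : ∀ {X Y B : Set} (g : Y → B → B) s (h : X → List Y) xs →
  foldr g s (concatMap h xs) ≡ foldr (λ x t → foldr g t (h x)) s xs
foldr-concatMap g s h [] = refl
foldr-concatMap g s h (x ∷ xs) = trans (foldr-++ g s (h x) (concat (map h xs)))
  (cong (λ t → foldr g t (h x)) (foldr-concatMap g s h xs))

flipIfInversion : ∀ {n} → Permutation′ n → Fin n → Fin n → Sgn → Sgn
flipIfInversion σ i j s =
  if does (i Fin.<? j) ∧ does ((σ ⟨$⟩ʳ j) Fin.<? (σ ⟨$⟩ʳ i)) then negˢ s else s

sgnPerm≡foldFin : ∀ {n} (σ : Permutation′ n) →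
  sgnPerm σ ≡ foldFin n (λ i t → foldFin n (flipIfInversion σ i) t) pos
sgnPerm≡foldFin {n} σ =
  trans (foldr-concatMap step pos (λ i → map (i ,_) (allFin n)) (allFin n))
  (trans (foldr-tabulate n id _ pos)
  (foldFin-cong n (λ i t → trans (foldr-map step (i ,_) t (allFin n)) (foldr-tabulate n id _ t)) pos))
  where
  step : Fin n × Fin n → Sgn → Sgn
  step (i , j) = flipIfInversion σ i j

sgnPerm-lift₀ : ∀ {n} (σ : Permutation′ n) → sgnPerm (lift₀ σ) ≡ sgnPerm σ
sgnPerm-lift₀ {n} σ = begin
  sgnPerm (lift₀ σ)                                              ≡⟨ sgnPerm≡foldFin (lift₀ σ) ⟩
  foldFin (suc n) (λ i t → foldFin (suc n) (flipIfInversion (lift₀ σ) i) t) pos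
    ≡⟨ foldFin-id (suc n) (λ i t → refl) _ ⟩
  foldFin n (λ i t → foldFin n (flipIfInversion σ i) t) pos     ≡⟨ sgnPerm≡foldFin σ ⟨
  sgnPerm σ                                                      ∎
  where open ≡-Reasoning

swap01 : ∀ {n} → Permutation′ (suc (suc n))
swap01 = permutation f f f∘f f∘f
  where
  f : ∀ {n} → Fin (suc (suc n)) → Fin (suc (suc n))
  f zero = suc zero
  f (suc zero) = zero
  f (suc (suc i)) = suc (suc i)
  f∘f : ∀ {n} (i : Fin (suc (suc n))) → f (f i) ≡ i
  f∘f zero = refl
  f∘f (suc zero) = refl
  f∘f (suc (suc i)) = refl

<ᵇ-asym : ∀ a b → (a ℕ.<ᵇ b) ∧ (b ℕ.<ᵇ a) ≡ false
<ᵇ-asym zero zero = refl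
<ᵇ-asym zero (suc b) = refl
<ᵇ-asym (suc a) zero = refl
<ᵇ-asym (suc a) (suc b) = <ᵇ-asym a b

-- (0 , 1) is the only inversion of swap01.
sgnPerm-swap01 : ∀ {n} → sgnPerm (swap01 {n}) ≡ neg
sgnPerm-swap01 {n} = trans (sgnPerm≡foldFin (swap01 {n}))
  (cong negˢ (trans (foldFin-id n (λ j u → refl) _) (foldFin-id (suc n) row pos)))
  where
  noInversion : ∀ (i j : Fin n) u →
    (if (toℕ i ℕ.<ᵇ toℕ j) ∧ (toℕ j ℕ.<ᵇ toℕ i) then negˢ u else u) ≡ u
  noInversion i j u rewrite <ᵇ-asym (toℕ i) (toℕ j) = refl
  row : ∀ (i : Fin (suc n)) t → foldFin (suc (suc n)) (flipIfInversion (swap01 {n}) (suc i)) t ≡ t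
  row zero t = foldFin-id n (λ j u → refl) t
  row (suc i) t = foldFin-id n (noInversion i) t

adjacentSwap : ∀ {A : Set} (P : List A) a b Q → Σ (Permutation′ (length (P ++ a ∷ b ∷ Q))) λ τ →
  permute (P ++ a ∷ b ∷ Q) τ ≡ P ++ b ∷ a ∷ Q × sgnPerm τ ≡ neg
adjacentSwap [] a b Q = swap01 , cong (λ X → b ∷ a ∷ X) (tabulate-lookup Q) , sgnPerm-swap01 {length Q}
adjacentSwap (c ∷ P) a b Q with adjacentSwap P a b Q
... | τ , τ-swaps , sgnτ = lift₀ τ , cong (c ∷_) τ-swaps , trans (sgnPerm-lift₀ τ) sgnτ

Alternatingˢ : ∀ {A : Set} → (List A → Sgn) → Set
Alternatingˢ e = ∀ P a b Q → e (P ++ a ∷ b ∷ Q) ≡ negˢ (e (P ++ b ∷ a ∷ Q))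

module _ {A : Set} {e : List A → Sgn} (alt : Alternatingˢ e) where

  altˢ-sp : ∀ {xs ys s} → xs ↭⟨ s ⟩ ys → ∀ W V → e (W ++ xs ++ V) ≡ s ·ˢ e (W ++ ys ++ V)
  altˢ-sp sp-refl W V = refl
  altˢ-sp (sp-prep {xs} {ys} {s} x p) W V = begin
    e (W ++ x ∷ xs ++ V)            ≡⟨ cong e (++-assoc W [ x ] (xs ++ V)) ⟨
    e ((W ++ [ x ]) ++ xs ++ V)     ≡⟨ altˢ-sp p (W ++ [ x ]) V ⟩
    s ·ˢ e ((W ++ [ x ]) ++ ys ++ V) ≡⟨ cong (λ X → s ·ˢ e X) (++-assoc W [ x ] (ys ++ V)) ⟩
    s ·ˢ e (W ++ x ∷ ys ++ V)       ∎
    where open ≡-Reasoning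
  altˢ-sp (sp-swap x y xs) W V = alt W x y (xs ++ V)
  altˢ-sp (sp-trans {zs = zs} {s = s} {t} p q) W V =
    trans (altˢ-sp p W V) (trans (cong (s ·ˢ_) (altˢ-sp q W V)) (sym (·ˢ-assoc s t (e (W ++ zs ++ V)))))

  altˢ-spˡ : ∀ {xs ys s} → xs ↭⟨ s ⟩ ys → ∀ W → e (W ++ xs) ≡ s ·ˢ e (W ++ ys)
  altˢ-spˡ {xs} {ys} {s} p W = begin
    e (W ++ xs)             ≡⟨ cong (λ X → e (W ++ X)) (++-identityʳ xs) ⟨
    e (W ++ xs ++ [])       ≡⟨ altˢ-sp p W [] ⟩
    s ·ˢ e (W ++ ys ++ [])  ≡⟨ cong (λ X → s ·ˢ e (W ++ X)) (++-identityʳ ys) ⟩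
    s ·ˢ e (W ++ ys)        ∎
    where open ≡-Reasoning

  altˢ-spʳ : ∀ {xs ys s} → xs ↭⟨ s ⟩ ys → ∀ V → e (xs ++ V) ≡ s ·ˢ e (ys ++ V)
  altˢ-spʳ p = altˢ-sp p []

  altˢ-sp₀ : ∀ {xs ys s} → xs ↭⟨ s ⟩ ys → e xs ≡ s ·ˢ e ys
  altˢ-sp₀ p = altˢ-spˡ p []

module _ {S : Set} (O : Orientation S) where
  open Orientation O

  ε-alternating : Alternatingˢ ε
  ε-alternating P a b Q with adjacentSwap P b a Q
  ... | τ , τ-swaps , sgnτ =
    trans (cong ε (sym τ-swaps)) (trans (ε-alt (P ++ b ∷ a ∷ Q) τ) (cong (_·ˢ ε (P ++ b ∷ a ∷ Q)) sgnτ))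

  ε-unit : ∀ {Y} → Unique Y → IsUnit (ε Y)
  ε-unit uY = ≢nul⇒IsUnit (ε-dist _ uY)

  -- Both signs describe how ε changes on the duplicate-free Y, where ε is nonzero: the
  -- first by the axiom ε-alt, the second by alternation.
  sgnPerm≡insertionSign : ∀ {Y : List S} {n} → Unique Y → length Y ≡ n →
    (σ : Permutation′ n) → sgnPerm σ ≡ insertionSign σ
  sgnPerm≡insertionSign {Y} uY refl σ =
    ·ˢ-cancelʳ (ε-unit uY) _ _ (trans (sym (ε-alt Y σ)) (altˢ-sp₀ ε-alternating (sp-permute Y σ)))

Enumerates : ∀ {A : Set} → List A → Set
Enumerates Y = Unique Y × (∀ x → x ∈ Y)

module _ {A : Set} where

  unique-resp-↭ : ∀ {xs ys : List A} → xs ↭ ys → Unique xs → Unique ys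
  unique-resp-↭ xs↭ys = Unique-resp-↭ (≡.setoid A) (↭⇒↭ₛ xs↭ys)

  enumerates-resp-↭ : ∀ {xs ys : List A} → xs ↭ ys → Enumerates xs → Enumerates ys
  enumerates-resp-↭ xs↭ys (uxs , cxs) = unique-resp-↭ xs↭ys uxs , λ x → ∈-resp-↭ xs↭ys (cxs x)

  unique-++⁻ : ∀ {xs ys : List A} → Unique (xs ++ ys) → Unique xs × (∀ {x} → x ∈ xs → x ∉ ys)
  unique-++⁻ {[]} _ = [] , λ ()
  unique-++⁻ {x ∷ xs} (x∉xs++ys ∷ u) with unique-++⁻ {xs} u
  ... | uxs , disjoint = ++⁻ˡ xs x∉xs++ys ∷ uxs , λ
    { (here refl) x∈ys → All.lookup x∉xs++ys (∈-++⁺ʳ xs x∈ys) refl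
    ; (there y∈xs) → disjoint y∈xs }

  unique-same-members⇒↭ : ∀ {xs ys : List A} → Unique xs → Unique ys →
    (∀ x → x ∈ xs → x ∈ ys) → (∀ x → x ∈ ys → x ∈ xs) → xs ↭ ys
  unique-same-members⇒↭ uxs uys xs⊆ys ys⊆xs =
    ∼bag⇒↭ (unique∧set⇒bag uxs uys (λ {x} → mk⇔ (xs⊆ys x) (ys⊆xs x)))

  data HasDuplicate : List A → Set where
    duplicate : ∀ P a Q R → HasDuplicate (P ++ a ∷ Q ++ a ∷ R)

  unique⊎duplicate : DecidableEquality A → ∀ Y → Unique Y ⊎ HasDuplicate Y
  unique⊎duplicate _≟_ [] = inj₁ []
  unique⊎duplicate _≟_ (y ∷ Y) with y ∈? Y
    where open import Data.List.Membership.DecPropositional _≟_ using (_∈?_)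
  ... | yes y∈Y with ∈-∃++ y∈Y
  ...   | Q , R , refl = inj₂ (duplicate [] y Q R)
  unique⊎duplicate _≟_ (y ∷ Y) | no y∉Y with unique⊎duplicate _≟_ Y
  ... | inj₁ uY = inj₁ (¬Any⇒All¬ Y y∉Y ∷ uY)
  ... | inj₂ (duplicate P a Q R) = inj₂ (duplicate (y ∷ P) a Q R)

  altˢ-duplicate : ∀ {e : List A → Sgn} → Alternatingˢ e → ∀ {Y} → HasDuplicate Y → e Y ≡ nul
  altˢ-duplicate {e} alt (duplicate P a Q R) = begin
    e (P ++ a ∷ Q ++ a ∷ R)                           ≡⟨ cong e (++-assoc P [ a ] (Q ++ a ∷ R)) ⟨
    e ((P ++ [ a ]) ++ Q ++ a ∷ R)                    ≡⟨ altˢ-spˡ {e = e} alt (sp-shift a Q R) (P ++ [ a ]) ⟩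
    k ·ˢ e ((P ++ [ a ]) ++ a ∷ Q ++ R)                ≡⟨ cong (λ X → k ·ˢ e X) (++-assoc P [ a ] (a ∷ Q ++ R)) ⟩
    k ·ˢ e (P ++ a ∷ a ∷ Q ++ R)                      ≡⟨ cong (k ·ˢ_) (negˢ-fixed⇒nul (alt P a a (Q ++ R))) ⟩
    k ·ˢ nul                                          ≡⟨ ·ˢ-zeroʳ k ⟩
    nul                                               ∎
    where
    open ≡-Reasoning
    k = parity (length Q)

orientations-proportional : ∀ {S : Set} → DecidableEquality S → (O O′ : Orientation S) →
  let ε = Orientation.ε O; ε′ = Orientation.ε O′ in
  ∀ {Z} → Enumerates Z → ∀ Y → (∀ x → x ∈ Y) → ε′ Y ≡ (ε′ Z ·ˢ ε Z) ·ˢ ε Y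
orientations-proportional _≟_ O O′ {Z} (uZ , cZ) Y cY with unique⊎duplicate _≟_ Y
... | inj₂ dup = trans (altˢ-duplicate {e = Orientation.ε O′} (ε-alternating O′) dup)
  (sym (trans (cong (k ·ˢ_) (altˢ-duplicate {e = Orientation.ε O} (ε-alternating O) dup)) (·ˢ-zeroʳ k)))
  where k = Orientation.ε O′ Z ·ˢ Orientation.ε O Z
... | inj₁ uY with ↭⇒sp (unique-same-members⇒↭ uY uZ (λ x _ → cZ x) (λ x _ → cY x))
...   | s , Y↭Z = begin
  ε′ Y                           ≡⟨ altˢ-sp₀ {e = ε′} (ε-alternating O′) Y↭Z ⟩
  s ·ˢ ε′ Z                      ≡⟨ ·ˢ-comm s (ε′ Z) ⟩
  ε′ Z ·ˢ s                      ≡⟨ cong (ε′ Z ·ˢ_) (unit-cancelˡ (ε-unit O uZ) s) ⟨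
  ε′ Z ·ˢ (ε Z ·ˢ (ε Z ·ˢ s))    ≡⟨ ·ˢ-assoc (ε′ Z) (ε Z) _ ⟨
  (ε′ Z ·ˢ ε Z) ·ˢ (ε Z ·ˢ s)    ≡⟨ cong ((ε′ Z ·ˢ ε Z) ·ˢ_) (·ˢ-comm (ε Z) s) ⟩
  (ε′ Z ·ˢ ε Z) ·ˢ (s ·ˢ ε Z)    ≡⟨ cong ((ε′ Z ·ˢ ε Z) ·ˢ_) (altˢ-sp₀ {e = ε} (ε-alternating O) Y↭Z) ⟨
  (ε′ Z ·ˢ ε Z) ·ˢ ε Y           ∎
  where
  open ≡-Reasoning
  ε = Orientation.ε O
  ε′ = Orientation.ε O′

module _ {p m : ℕ} where

  Pseq++Eseq-enumerates : ∀ {Ps : List (Fin p)} {Es : List (Fin m)} → IsOrdering Ps → IsOrdering Es →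
    Enumerates (Pseq Ps ++ Eseq Es)
  Pseq++Eseq-enumerates {Ps} {Es} (uP , cP) (uE , cE) =
    ++⁺ (map⁺ inj₁-injective uP) (map⁺ inj₂-injective uE) disjoint , complete
    where
    disjoint : ∀ {x} → ¬ (x ∈ Pseq Ps × x ∈ Eseq Es)
    disjoint (x∈P , x∈E) with ∈-map⁻ inj₁ x∈P | ∈-map⁻ inj₂ x∈E
    ... | _ , _ , refl | _ , _ , ()
    complete : ∀ x → x ∈ Pseq Ps ++ Eseq Es
    complete (inj₁ i) = ∈-++⁺ˡ (∈-map⁺ inj₁ (cP i))
    complete (inj₂ e) = ∈-++⁺ʳ (Pseq Ps) (∈-map⁺ inj₂ (cE e))

  allG-enumerates : Enumerates (allG p m)
  allG-enumerates = Pseq++Eseq-enumerates (allFin⁺ p , ∈-allFin) (allFin⁺ m , ∈-allFin)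

  private
    ∉? : (X : List (G p m)) → Decidable (_∉ X)
    ∉? X x = ¬? (x ∈? X)
      where open import Data.List.Membership.DecPropositional _≟G_ using (_∈?_)

  compl-unique : ∀ X → Unique (compl X)
  compl-unique X = filter⁺ (∉? X) (proj₁ allG-enumerates)

  ∈-compl⁺ : ∀ {X x} → x ∉ X → x ∈ compl X
  ∈-compl⁺ {X} {x} x∉X = ∈-filter⁺ (∉? X) (proj₂ allG-enumerates x) x∉X

  ∈-compl⁻ : ∀ {X x} → x ∈ compl X → x ∉ X
  ∈-compl⁻ {X} x∈X̄ = proj₂ (∈-filter⁻ (∉? X) {xs = allG p m} x∈X̄)

  compl++-complete : ∀ X x → x ∈ compl X ++ X
  compl++-complete X x with x ∈? X
    where open import Data.List.Membership.DecPropositional _≟G_ using (_∈?_)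
  ... | yes x∈X = ∈-++⁺ʳ (compl X) x∈X
  ... | no x∉X = ∈-++⁺ˡ (∈-compl⁺ x∉X)

  compl-resp-↭ : ∀ {X Y} → X ↭ Y → compl X ≡ compl Y
  compl-resp-↭ {X} {Y} X↭Y = filter-≐ (∉? X) (∉? Y)
    ((λ x∉X x∈Y → x∉X (∈-resp-↭ (↭-sym X↭Y) x∈Y)) , (λ x∉Y x∈X → x∉Y (∈-resp-↭ X↭Y x∈X))) (allG p m)

  compl-↭ : ∀ {X X′} → Enumerates (X ++ X′) → compl X′ ↭ X
  compl-↭ {X} {X′} (uXX′ , cXX′) = unique-same-members⇒↭ (compl-unique X′) uX X̄′⊆X X⊆X̄′
    where
    uX = proj₁ (unique-++⁻ uXX′)
    X̄′⊆X : ∀ x → x ∈ compl X′ → x ∈ X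
    X̄′⊆X x x∈X̄′ with ∈-++⁻ X (cXX′ x)
    ... | inj₁ x∈X = x∈X
    ... | inj₂ x∈X′ = contradiction x∈X′ (∈-compl⁻ x∈X̄′)
    X⊆X̄′ : ∀ x → x ∈ X → x ∈ compl X′
    X⊆X̄′ x x∈X = ∈-compl⁺ (proj₂ (unique-++⁻ uXX′) x∈X)

subsetsC-↭ : ∀ {A : Set} (E : List A) {B C} → (B , C) ∈ subsetsC E → B ++ C ↭ E
subsetsC-↭ [] (here refl) = ↭.refl
subsetsC-↭ (e ∷ E) BC∈ with find (∈-concatMap⁻ _ {xs = subsetsC E} BC∈)
... | _ , BC′∈ , here refl = ↭.prep e (subsetsC-↭ E BC′∈)
... | (B , C) , BC′∈ , there (here refl) = ↭.trans (↭ₚ.shift e B C) (↭.prep e (subsetsC-↭ E BC′∈))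

module WithField {c ℓ} (F : Field c ℓ) where
  open ExtAlg₂ F renaming (refl to ≈-refl; sym to ≈-sym; trans to ≈-trans; reflexive to ≈-reflexive)
  open import Algebra.Properties.Ring ring
    using (-1*x≈-x; -‿distribˡ-*; -‿distribʳ-*; -‿involutive; -0#≈0#; -‿+-comm)
  open import Relation.Binary.Reasoning.Setoid setoid
  open import Algebra.Properties.CommutativeSemigroup +-commutativeSemigroup
    using () renaming (interchange to +-interchange)
  open import Algebra.Properties.CommutativeSemigroup *-commutativeSemigroup
    using () renaming (interchange to *-interchange; x∙yz≈y∙xz to *-x∙yz≈y∙xz; xy∙z≈y∙xz to *-xy∙z≈y∙xz)

  Splitting : Set → Set
  Splitting A = List A × List A × Sgn

  splitCons : ∀ {A : Set} → A → Splitting A → List (Splitting A)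
  splitCons a (L , R , s) = (a ∷ L , R , s) ∷ (L , a ∷ R , parity (length L) ·ˢ s) ∷ []

  private
    prependPair : ∀ {A : Set} → A → A → List (Splitting A) → List (Splitting A)
    prependPair x y ((a ∷ L₁ , R₁ , s₁) ∷ (L₂ , R₂ , s₂) ∷ []) =
      (a ∷ x ∷ y ∷ L₁ , R₁ , s₁) ∷ (x ∷ y ∷ L₂ , R₂ , s₂) ∷ []
    prependPair x y other = other

    StepOfSplits : ∀ {A : Set} → A → List A → (Splitting A → List (Splitting A)) → Set
    StepOfSplits a Z φ = splits (a ∷ Z) ≡ concatMap φ (splits Z)
      × (∀ R s → φ ([] , R , s) ≡ splitCons a ([] , R , s))
      × (∀ x R s → φ (x ∷ [] , R , s) ≡ splitCons a (x ∷ [] , R , s))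
      × (∀ x y L R s → φ (x ∷ y ∷ L , R , s) ≡ prependPair x y (φ (L , R , s)))

    stepOfSplits : ∀ {A : Set} (a : A) Z → Σ _ (StepOfSplits a Z)
    stepOfSplits a Z = _ , refl , (λ R s → refl) , (λ x R s → refl) , (λ x y L R s → refl)

  -- The step function in the definition of splits tests parity with a local function that
  -- cannot be named here; it is identified with splitCons by the recursion on L that both obey.
  splits-∷ : ∀ {A : Set} (a : A) Z → splits (a ∷ Z) ≡ concatMap (splitCons a) (splits Z)
  splits-∷ a Z with stepOfSplits a Z
  ... | φ , unfold , φ[] , φ[x] , φ[xy] = trans unfold (concatMap-cong (λ t → φ≗splitCons t) (splits Z))
    where
    φ≗splitCons : ∀ t → φ t ≡ splitCons a t
    φ≗splitCons ([] , R , s) = φ[] R s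
    φ≗splitCons (x ∷ [] , R , s) = φ[x] x R s
    φ≗splitCons (x ∷ y ∷ L , R , s) = trans (φ[xy] x y L R s) (cong (prependPair x y) (φ≗splitCons (L , R , s)))

  ⟦unit⟧² : ∀ {s} → IsUnit s → ⟦ s ⟧ˢ * ⟦ s ⟧ˢ ≈ 1#
  ⟦unit⟧² pos-unit = *-identityˡ 1#
  ⟦unit⟧² neg-unit = ≈-trans (-1*x≈-x (- 1#)) (-‿involutive 1#)

  ⟦·ˢ⟧ : ∀ s t → ⟦ s ·ˢ t ⟧ˢ ≈ ⟦ s ⟧ˢ * ⟦ t ⟧ˢ
  ⟦·ˢ⟧ pos t = ≈-sym (*-identityˡ _)
  ⟦·ˢ⟧ neg pos = ≈-sym (*-identityʳ _)
  ⟦·ˢ⟧ neg neg = ≈-sym (⟦unit⟧² neg-unit)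
  ⟦·ˢ⟧ neg nul = ≈-sym (zeroʳ _)
  ⟦·ˢ⟧ nul t = ≈-sym (zeroˡ _)

  ⟦negˢ⟧ : ∀ s → ⟦ negˢ s ⟧ˢ ≈ - ⟦ s ⟧ˢ
  ⟦negˢ⟧ pos = ≈-refl
  ⟦negˢ⟧ neg = ≈-sym (-‿involutive 1#)
  ⟦negˢ⟧ nul = ≈-sym -0#≈0#

  ⟦unit⟧-cancelˡ : ∀ {s} → IsUnit s → ∀ x → ⟦ s ⟧ˢ * (⟦ s ⟧ˢ * x) ≈ x
  ⟦unit⟧-cancelˡ u x = ≈-trans (≈-sym (*-assoc _ _ _)) (≈-trans (*-congʳ (⟦unit⟧² u)) (*-identityˡ x))

  sumK-cong∈ : ∀ {X : Set} {f g : X → Carrier} xs → (∀ x → x ∈ xs → f x ≈ g x) →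
    sumK (map f xs) ≈ sumK (map g xs)
  sumK-cong∈ [] f≈g = ≈-refl
  sumK-cong∈ (x ∷ xs) f≈g = +-cong (f≈g x (here refl)) (sumK-cong∈ xs (λ y y∈xs → f≈g y (there y∈xs)))

  sumK-cong : ∀ {X : Set} {f g : X → Carrier} → (∀ x → f x ≈ g x) → ∀ xs → sumK (map f xs) ≈ sumK (map g xs)
  sumK-cong f≈g xs = sumK-cong∈ xs (λ x _ → f≈g x)

  sumK-+ : ∀ {X : Set} (f g : X → Carrier) xs →
    sumK (map (λ x → f x + g x) xs) ≈ sumK (map f xs) + sumK (map g xs)
  sumK-+ f g [] = ≈-sym (+-identityˡ 0#)
  sumK-+ f g (x ∷ xs) = ≈-trans (+-congˡ (sumK-+ f g xs)) (+-interchange (f x) (g x) _ _)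

  *-distribˡ-sumK : ∀ {X : Set} k (f : X → Carrier) xs → k * sumK (map f xs) ≈ sumK (map (λ x → k * f x) xs)
  *-distribˡ-sumK k f [] = zeroʳ k
  *-distribˡ-sumK k f (x ∷ xs) = ≈-trans (distribˡ k _ _) (+-congˡ (*-distribˡ-sumK k f xs))

  -‿sumK : ∀ {X : Set} (f : X → Carrier) xs → sumK (map (λ x → - f x) xs) ≈ - sumK (map f xs)
  -‿sumK f [] = ≈-sym -0#≈0#
  -‿sumK f (x ∷ xs) = ≈-trans (+-congˡ (-‿sumK f xs)) (-‿+-comm _ _)

  sumK-zero : ∀ {X : Set} {f : X → Carrier} → (∀ x → f x ≈ 0#) → ∀ xs → sumK (map f xs) ≈ 0#
  sumK-zero f≈0 [] = ≈-refl
  sumK-zero f≈0 (x ∷ xs) = ≈-trans (+-cong (f≈0 x) (sumK-zero f≈0 xs)) (+-identityˡ 0#)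

  sumK-++ : ∀ (xs ys : List Carrier) → sumK (xs ++ ys) ≈ sumK xs + sumK ys
  sumK-++ [] ys = ≈-sym (+-identityˡ _)
  sumK-++ (x ∷ xs) ys = ≈-trans (+-congˡ (sumK-++ xs ys)) (≈-sym (+-assoc _ _ _))

  sumK-concatMap : ∀ {X Y : Set} (f : Y → Carrier) (h : X → List Y) xs →
    sumK (map f (concatMap h xs)) ≈ sumK (map (λ x → sumK (map f (h x))) xs)
  sumK-concatMap f h [] = ≈-refl
  sumK-concatMap f h (x ∷ xs) = begin
    sumK (map f (h x ++ concatMap h xs))                ≡⟨ cong sumK (map-++ f (h x) (concatMap h xs)) ⟩
    sumK (map f (h x) ++ map f (concatMap h xs))        ≈⟨ sumK-++ (map f (h x)) _ ⟩
    sumK (map f (h x)) + sumK (map f (concatMap h xs))  ≈⟨ +-congˡ (sumK-concatMap f h xs) ⟩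
    sumK (map f (h x)) + sumK (map (λ x → sumK (map f (h x))) xs) ∎

  Alternating : ∀ {A : Set} → (List A → Carrier) → Set ℓ
  Alternating f = ∀ P a b Q → f (P ++ a ∷ b ∷ Q) ≈ - f (P ++ b ∷ a ∷ Q)

  module _ {A : Set} {f : List A → Carrier} (alt : Alternating f) where

    alt-sp : ∀ {xs ys s} → xs ↭⟨ s ⟩ ys → ∀ W V → f (W ++ xs ++ V) ≈ ⟦ s ⟧ˢ * f (W ++ ys ++ V)
    alt-sp sp-refl W V = ≈-sym (*-identityˡ _)
    alt-sp (sp-prep {xs} {ys} {s} x p) W V = begin
      f (W ++ x ∷ xs ++ V)                  ≡⟨ cong f (++-assoc W [ x ] (xs ++ V)) ⟨
      f ((W ++ [ x ]) ++ xs ++ V)           ≈⟨ alt-sp p (W ++ [ x ]) V ⟩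
      ⟦ s ⟧ˢ * f ((W ++ [ x ]) ++ ys ++ V)  ≡⟨ cong (λ X → ⟦ s ⟧ˢ * f X) (++-assoc W [ x ] (ys ++ V)) ⟩
      ⟦ s ⟧ˢ * f (W ++ x ∷ ys ++ V)         ∎
    alt-sp (sp-swap x y xs) W V = ≈-trans (alt W x y (xs ++ V)) (≈-sym (-1*x≈-x _))
    alt-sp (sp-trans {xs} {ys} {zs} {s} {t} p q) W V = begin
      f (W ++ xs ++ V)                      ≈⟨ alt-sp p W V ⟩
      ⟦ s ⟧ˢ * f (W ++ ys ++ V)             ≈⟨ *-congˡ (alt-sp q W V) ⟩
      ⟦ s ⟧ˢ * (⟦ t ⟧ˢ * f (W ++ zs ++ V))  ≈⟨ *-assoc _ _ _ ⟨
      ⟦ s ⟧ˢ * ⟦ t ⟧ˢ * f (W ++ zs ++ V)    ≈⟨ *-congʳ (⟦·ˢ⟧ s t) ⟨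
      ⟦ s ·ˢ t ⟧ˢ * f (W ++ zs ++ V)        ∎

    alt-sp₀ : ∀ {xs ys s} → xs ↭⟨ s ⟩ ys → f xs ≈ ⟦ s ⟧ˢ * f ys
    alt-sp₀ {xs} {ys} {s} p = begin
      f xs                     ≡⟨ cong f (++-identityʳ xs) ⟨
      f (xs ++ [])             ≈⟨ alt-sp p [] [] ⟩
      ⟦ s ⟧ˢ * f (ys ++ [])    ≡⟨ cong (λ X → ⟦ s ⟧ˢ * f X) (++-identityʳ ys) ⟩
      ⟦ s ⟧ˢ * f ys            ∎

    alt-prefix : ∀ W → Alternating (λ X → f (W ++ X))
    alt-prefix W P a b Q = begin
      f (W ++ P ++ a ∷ b ∷ Q)      ≡⟨ cong f (++-assoc W P (a ∷ b ∷ Q)) ⟨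
      f ((W ++ P) ++ a ∷ b ∷ Q)    ≈⟨ alt (W ++ P) a b Q ⟩
      - f ((W ++ P) ++ b ∷ a ∷ Q)  ≡⟨ cong (-_ ∘ f) (++-assoc W P (b ∷ a ∷ Q)) ⟩
      - f (W ++ P ++ b ∷ a ∷ Q)    ∎

    alt-suffix : ∀ V → Alternating (λ X → f (X ++ V))
    alt-suffix V P a b Q = begin
      f ((P ++ a ∷ b ∷ Q) ++ V)    ≡⟨ cong f (++-assoc P (a ∷ b ∷ Q) V) ⟩
      f (P ++ a ∷ b ∷ Q ++ V)      ≈⟨ alt P a b (Q ++ V) ⟩
      - f (P ++ b ∷ a ∷ Q ++ V)    ≡⟨ cong (-_ ∘ f) (++-assoc P (b ∷ a ∷ Q) V) ⟨
      - f ((P ++ b ∷ a ∷ Q) ++ V)  ∎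

    alt-map : ∀ {B : Set} (h : B → A) → Alternating (f ∘ map h)
    alt-map h P a b Q = begin
      f (map h (P ++ a ∷ b ∷ Q))          ≡⟨ cong f (map-++ h P (a ∷ b ∷ Q)) ⟩
      f (map h P ++ h a ∷ h b ∷ map h Q)  ≈⟨ alt (map h P) (h a) (h b) (map h Q) ⟩
      - f (map h P ++ h b ∷ h a ∷ map h Q) ≡⟨ cong (-_ ∘ f) (map-++ h P (b ∷ a ∷ Q)) ⟨
      - f (map h (P ++ b ∷ a ∷ Q))        ∎

    alt-scale : ∀ k {g : List A → Carrier} → (∀ X → g X ≈ k * f X) → Alternating g
    alt-scale k {g} g≈kf P a b Q = begin
      g (P ++ a ∷ b ∷ Q)        ≈⟨ g≈kf _ ⟩
      k * f (P ++ a ∷ b ∷ Q)    ≈⟨ *-congˡ (alt P a b Q) ⟩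
      k * - f (P ++ b ∷ a ∷ Q)  ≈⟨ -‿distribʳ-* _ _ ⟨
      - (k * f (P ++ b ∷ a ∷ Q)) ≈⟨ -‿cong (g≈kf _) ⟨
      - g (P ++ b ∷ a ∷ Q)      ∎

  ⟦⟧-alternating : ∀ {A : Set} {e : List A → Sgn} → Alternatingˢ e → Alternating (λ X → ⟦ e X ⟧ˢ)
  ⟦⟧-alternating {e = e} alte P a b Q =
    ≈-trans (≈-reflexive (cong ⟦_⟧ˢ (alte P a b Q))) (⟦negˢ⟧ (e (P ++ b ∷ a ∷ Q)))

  alt-permute : ∀ {S A : Set} (O : Orientation S) {Y : List S} → Unique Y →
    ∀ {f : List A → Carrier} → Alternating f → ∀ X → length Y ≡ length X →
    (σ : Permutation′ (length X)) → f (permute X σ) ≈ ⟦ sgnPerm σ ⟧ˢ * f X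
  alt-permute O uY {f} altf X |Y|≡|X| σ = ≈-trans (alt-sp₀ {f = f} altf (sp-permute X σ))
    (*-congʳ (≈-reflexive (cong ⟦_⟧ˢ (sym (sgnPerm≡insertionSign O uY |Y|≡|X| σ)))))

  alt-*-permute : ∀ {A : Set} {f h : List A → Carrier} → Alternating f → Alternating h →
    ∀ X (σ : Permutation′ (length X)) → f (permute X σ) * h (permute X σ) ≈ f X * h X
  alt-*-permute {f = f} {h} altf alth X σ = begin
    f (permute X σ) * h (permute X σ)  ≈⟨ *-cong (alt-sp₀ {f = f} altf Xσ↭X) (alt-sp₀ {f = h} alth Xσ↭X) ⟩
    ⟦ s ⟧ˢ * f X * (⟦ s ⟧ˢ * h X)      ≈⟨ *-interchange _ _ _ _ ⟩
    ⟦ s ⟧ˢ * ⟦ s ⟧ˢ * (f X * h X)      ≈⟨ *-congʳ (⟦unit⟧² (sp-unit Xσ↭X)) ⟩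
    1# * (f X * h X)                   ≈⟨ *-identityˡ _ ⟩
    f X * h X                          ∎
    where
    s = insertionSign σ
    Xσ↭X = sp-permute X σ

  splitSum : ∀ {A : Set} → (List A → List A → Sgn → Carrier) → List A → Carrier
  splitSum F Z = sumK (map (λ (L , R , s) → F L R s) (splits Z))

  splitSum-cong : ∀ {A : Set} {F G : List A → List A → Sgn → Carrier} → (∀ L R s → F L R s ≈ G L R s) →
    ∀ Z → splitSum F Z ≈ splitSum G Z
  splitSum-cong F≈G Z = sumK-cong (λ t → F≈G _ _ _) (splits Z)

  splitSum-∷ : ∀ {A : Set} (F : List A → List A → Sgn → Carrier) a Z →
    splitSum F (a ∷ Z) ≈
      splitSum (λ L R s → F (a ∷ L) R s) Z + splitSum (λ L R s → F L (a ∷ R) (parity (length L) ·ˢ s)) Z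
  splitSum-∷ F a Z = begin
    splitSum F (a ∷ Z)                                       ≡⟨ cong (sumK ∘ map _) (splits-∷ a Z) ⟩
    sumK (map _ (concatMap (splitCons a) (splits Z)))       ≈⟨ sumK-concatMap _ (splitCons a) (splits Z) ⟩
    sumK (map (λ t → _ + (_ + 0#)) (splits Z))       ≈⟨ sumK-cong (λ _ → +-congˡ (+-identityʳ _)) (splits Z) ⟩
    sumK (map (λ t → _ + _) (splits Z))                     ≈⟨ sumK-+ _ _ (splits Z) ⟩
    splitSum (λ L R s → F (a ∷ L) R s) Z + splitSum (λ L R s → F L (a ∷ R) (parity (length L) ·ˢ s)) Z ∎

  splitSum-zero : ∀ {A : Set} {F : List A → List A → Sgn → Carrier} → (∀ L R s → F L R s ≈ 0#) →
    ∀ Z → splitSum F Z ≈ 0#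
  splitSum-zero F≈0 Z = sumK-zero (λ t → F≈0 _ _ _) (splits Z)

  signedSplitSum : ∀ {A : Set} → (List A → List A → Carrier) → List A → Carrier
  signedSplitSum G = splitSum (λ L R s → ⟦ s ⟧ˢ * G L R)

  ∧E≈signedSplitSum : ∀ {A : Set} (x y : Ext A) Z → (x ∧E y) Z ≈ signedSplitSum (λ L R → x L * y R) Z
  ∧E≈signedSplitSum x y Z = sumK-cong (λ t → ≈-refl) (splits Z)

  signedSplitSum-cong : ∀ {A : Set} {G H : List A → List A → Carrier} → (∀ L R → G L R ≈ H L R) →
    ∀ Z → signedSplitSum G Z ≈ signedSplitSum H Z
  signedSplitSum-cong G≈H = splitSum-cong (λ L R s → *-congˡ (G≈H L R))

  signedSplitSum-neg : ∀ {A : Set} {G H : List A → List A → Carrier} → (∀ L R → G L R ≈ - H L R) →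
    ∀ Z → signedSplitSum G Z ≈ - signedSplitSum H Z
  signedSplitSum-neg G≈-H Z = ≈-trans
    (splitSum-cong (λ L R s → ≈-trans (*-congˡ (G≈-H L R)) (≈-sym (-‿distribʳ-* _ _))) Z)
    (-‿sumK _ (splits Z))

  signedSplitSum-∷ : ∀ {A : Set} (G : List A → List A → Carrier) a Z →
    signedSplitSum G (a ∷ Z) ≈
      signedSplitSum (λ L R → G (a ∷ L) R) Z + signedSplitSum (λ L R → ⟦ parity (length L) ⟧ˢ * G L (a ∷ R)) Z
  signedSplitSum-∷ G a Z = ≈-trans (splitSum-∷ _ a Z)
    (+-congˡ (splitSum-cong (λ L R s → ≈-trans (*-congʳ (⟦·ˢ⟧ (parity (length L)) s)) (*-xy∙z≈y∙xz _ _ _)) Z))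

  ⟦parity-∷⟧ : ∀ {A : Set} (x : A) L X → ⟦ parity (length (x ∷ L)) ⟧ˢ * X ≈ - (⟦ parity (length L) ⟧ˢ * X)
  ⟦parity-∷⟧ x L X = begin
    ⟦ parity (suc (length L)) ⟧ˢ * X  ≡⟨ cong (λ s → ⟦ s ⟧ˢ * X) (parity-suc (length L)) ⟩
    ⟦ negˢ (parity (length L)) ⟧ˢ * X ≈⟨ *-congʳ (⟦negˢ⟧ (parity (length L))) ⟩
    - ⟦ parity (length L) ⟧ˢ * X      ≈⟨ -‿distribˡ-* _ _ ⟨
    - (⟦ parity (length L) ⟧ˢ * X)    ∎

  neg-cross : ∀ {a b c d a′ b′ c′ d′} → a ≈ - a′ → b ≈ - c′ → c ≈ - b′ → d ≈ - d′ →
    (a + b) + (c + d) ≈ - ((a′ + b′) + (c′ + d′))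
  neg-cross {a′ = a′} {b′} {c′} {d′} a≈ b≈ c≈ d≈ = begin
    _ + _ + (_ + _)                ≈⟨ +-cong (+-cong a≈ b≈) (+-cong c≈ d≈) ⟩
    - a′ + - c′ + (- b′ + - d′)    ≈⟨ +-interchange _ _ _ _ ⟩
    - a′ + - b′ + (- c′ + - d′)    ≈⟨ +-cong (-‿+-comm a′ b′) (-‿+-comm c′ d′) ⟩
    - (a′ + b′) + - (c′ + d′)      ≈⟨ -‿+-comm _ _ ⟩
    - (a′ + b′ + (c′ + d′))        ∎

  AlternatingInBoth : ∀ {A : Set} → (List A → List A → Carrier) → Set ℓ
  AlternatingInBoth G = (∀ R → Alternating (λ L → G L R)) × (∀ L → Alternating (G L))

  signedSplitSum-alternating : ∀ {A : Set} {G : List A → List A → Carrier} →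
    AlternatingInBoth G → Alternating (signedSplitSum G)
  signedSplitSum-alternating {G = G} (altL , altR) [] a b Q = begin
    signedSplitSum G (a ∷ b ∷ Q)                  ≈⟨ expand a b ⟩
    T₁ a b + T₂ a b + (T₃ a b + T₄ a b)            ≈⟨ neg-cross
      (signedSplitSum-neg (λ L R → altL R [] a b L) Q)
      (signedSplitSum-neg (λ L R → ≈-trans (≈-sym (-‿involutive _)) (-‿cong (≈-sym (⟦parity-∷⟧ a L _)))) Q)
      (signedSplitSum-neg (λ L R → ⟦parity-∷⟧ b L _) Q)
      (signedSplitSum-neg (λ L R → altR L [] a b R) Q) ⟩
    - (T₁ b a + T₂ b a + (T₃ b a + T₄ b a))        ≈⟨ -‿cong (expand b a) ⟨
    - signedSplitSum G (b ∷ a ∷ Q)                ∎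
    where
    T₁ T₂ T₃ T₄ : _ → _ → Carrier
    T₁ a b = signedSplitSum (λ L R → G (a ∷ b ∷ L) R) Q
    T₂ a b = signedSplitSum (λ L R → ⟦ parity (length L) ⟧ˢ * G (a ∷ L) (b ∷ R)) Q
    T₃ a b = signedSplitSum (λ L R → ⟦ parity (length (b ∷ L)) ⟧ˢ * G (b ∷ L) (a ∷ R)) Q
    T₄ a b = signedSplitSum (λ L R → G L (a ∷ b ∷ R)) Q
    expand : ∀ a b → signedSplitSum G (a ∷ b ∷ Q) ≈ T₁ a b + T₂ a b + (T₃ a b + T₄ a b)
    expand a b = ≈-trans (signedSplitSum-∷ G a (b ∷ Q))
      (+-cong (signedSplitSum-∷ _ b Q)
        (≈-trans (signedSplitSum-∷ _ b Q)
          (+-congˡ (signedSplitSum-cong (λ L R → ⟦unit⟧-cancelˡ (IsUnit-parity (length L)) _) Q))))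
  signedSplitSum-alternating {G = G} (altL , altR) (c ∷ P) a b Q = begin
    signedSplitSum G (c ∷ P ++ a ∷ b ∷ Q)                  ≈⟨ signedSplitSum-∷ G c (P ++ a ∷ b ∷ Q) ⟩
    signedSplitSum G₁ (P ++ a ∷ b ∷ Q) + signedSplitSum G₂ (P ++ a ∷ b ∷ Q)
      ≈⟨ +-cong (signedSplitSum-alternating G₁-alt P a b Q) (signedSplitSum-alternating G₂-alt P a b Q) ⟩
    - signedSplitSum G₁ (P ++ b ∷ a ∷ Q) + - signedSplitSum G₂ (P ++ b ∷ a ∷ Q) ≈⟨ -‿+-comm _ _ ⟩
    - (signedSplitSum G₁ (P ++ b ∷ a ∷ Q) + signedSplitSum G₂ (P ++ b ∷ a ∷ Q))
      ≈⟨ -‿cong (signedSplitSum-∷ G c (P ++ b ∷ a ∷ Q)) ⟨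
    - signedSplitSum G (c ∷ P ++ b ∷ a ∷ Q)                ∎
    where
    G₁ G₂ : _ → _ → Carrier
    G₁ L R = G (c ∷ L) R
    G₂ L R = ⟦ parity (length L) ⟧ˢ * G L (c ∷ R)
    G₁-alt : AlternatingInBoth G₁
    G₁-alt = (λ R P → altL R (c ∷ P)) , (λ L → altR (c ∷ L))
    G₂-alt : AlternatingInBoth G₂
    G₂-alt = (λ R P a b Q → begin
                ⟦ parity (length (P ++ a ∷ b ∷ Q)) ⟧ˢ * G (P ++ a ∷ b ∷ Q) (c ∷ R)
                  ≡⟨ cong (λ n → ⟦ parity n ⟧ˢ * G (P ++ a ∷ b ∷ Q) (c ∷ R))
                          (trans (length-++ P) (sym (length-++ P))) ⟩
                ⟦ parity (length (P ++ b ∷ a ∷ Q)) ⟧ˢ * G (P ++ a ∷ b ∷ Q) (c ∷ R)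
                  ≈⟨ *-congˡ (altL (c ∷ R) P a b Q) ⟩
                ⟦ parity (length (P ++ b ∷ a ∷ Q)) ⟧ˢ * - G (P ++ b ∷ a ∷ Q) (c ∷ R)
                  ≈⟨ -‿distribʳ-* _ _ ⟨
                - (⟦ parity (length (P ++ b ∷ a ∷ Q)) ⟧ˢ * G (P ++ b ∷ a ∷ Q) (c ∷ R)) ∎)
           , (λ L → alt-scale {f = λ X → G L (c ∷ X)} (alt-prefix {f = G L} (altR L) [ c ]) _ (λ X → ≈-refl))

  ∧E-alternating : ∀ {A : Set} {x y : Ext A} → Alternating x → Alternating y → Alternating (x ∧E y)
  ∧E-alternating {x = x} {y} altx alty P a b Q = begin
    (x ∧E y) (P ++ a ∷ b ∷ Q)                       ≈⟨ ∧E≈signedSplitSum x y (P ++ a ∷ b ∷ Q) ⟩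
    signedSplitSum (λ L R → x L * y R) (P ++ a ∷ b ∷ Q) ≈⟨ signedSplitSum-alternating (altL , altR) P a b Q ⟩
    - signedSplitSum (λ L R → x L * y R) (P ++ b ∷ a ∷ Q) ≈⟨ -‿cong (∧E≈signedSplitSum x y (P ++ b ∷ a ∷ Q)) ⟨
    - (x ∧E y) (P ++ b ∷ a ∷ Q)                     ∎
    where
    altL : ∀ R → Alternating (λ L → x L * y R)
    altL R = alt-scale {f = x} altx (y R) (λ L → *-comm (x L) (y R))
    altR : ∀ L → Alternating (λ R → x L * y R)
    altR L = alt-scale {f = y} alty (x L) (λ R → ≈-refl)

  ∧E-scale : ∀ {A : Set} {x x′ y y′ : Ext A} a b → (∀ L → x′ L ≈ a * x L) → (∀ R → y′ R ≈ b * y R) →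
    ∀ Z → (x′ ∧E y′) Z ≈ (a * b) * (x ∧E y) Z
  ∧E-scale {x = x} {x′} {y} {y′} a b x′≈ax y′≈by Z =
    ≈-trans (sumK-cong termwise (splits Z)) (≈-sym (*-distribˡ-sumK _ _ (splits Z)))
    where
    termwise : ∀ (t : Splitting _) → let (L , R , s) = t in
      ⟦ s ⟧ˢ * (x′ L * y′ R) ≈ (a * b) * (⟦ s ⟧ˢ * (x L * y R))
    termwise (L , R , s) = begin
      ⟦ s ⟧ˢ * (x′ L * y′ R)             ≈⟨ *-congˡ (*-cong (x′≈ax L) (y′≈by R)) ⟩
      ⟦ s ⟧ˢ * (a * x L * (b * y R))     ≈⟨ *-congˡ (*-interchange _ _ _ _) ⟩
      ⟦ s ⟧ˢ * (a * b * (x L * y R))     ≈⟨ *-x∙yz≈y∙xz _ _ _ ⟩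
      a * b * (⟦ s ⟧ˢ * (x L * y R))     ∎

  splits-sp : ∀ {A : Set} (Z : List A) {L R s} → (L , R , s) ∈ splits Z → Z ↭⟨ s ⟩ L ++ R
  splits-sp [] (here refl) = sp-refl
  splits-sp (a ∷ Z) t∈
    with find (∈-concatMap⁻ (splitCons a) {xs = splits Z} (subst ((_ , _ , _) ∈_) (splits-∷ a Z) t∈))
  ... | _ , t′∈ , here refl = sp-prep a (splits-sp Z t′∈)
  ... | (L , R , s) , t′∈ , there (here refl) = sp-subst (·ˢ-comm s (parity (length L)))
    (sp-trans (sp-prep a (splits-sp Z t′∈)) (sp-sym (sp-shift a L R)))

  -- For each splitting (L , R , s), e (map f Z) = s · e (map f (L ++ R)) by splits-sp, and s² = 1.
  signedSplitSum-absorb : ∀ {A S : Set} {e : List S → Sgn} → Alternatingˢ e → (f : A → S) →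
    ∀ (T : List A → List A → Carrier) Z →
    ⟦ e (map f Z) ⟧ˢ * signedSplitSum T Z ≈ splitSum (λ L R _ → ⟦ e (map f (L ++ R)) ⟧ˢ * T L R) Z
  signedSplitSum-absorb {e = e} alte f T Z =
    ≈-trans (*-distribˡ-sumK _ _ (splits Z)) (sumK-cong∈ (splits Z) termwise)
    where
    termwise : ∀ t → t ∈ splits Z → let (L , R , s) = t in
      ⟦ e (map f Z) ⟧ˢ * (⟦ s ⟧ˢ * T L R) ≈ ⟦ e (map f (L ++ R)) ⟧ˢ * T L R
    termwise (L , R , s) t∈ = begin
      ⟦ e (map f Z) ⟧ˢ * (⟦ s ⟧ˢ * T L R)       ≡⟨ cong (λ s′ → ⟦ s′ ⟧ˢ * (⟦ s ⟧ˢ * T L R)) e-fZ ⟩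
      ⟦ s ·ˢ e′ ⟧ˢ * (⟦ s ⟧ˢ * T L R)           ≈⟨ *-congʳ (⟦·ˢ⟧ s e′) ⟩
      ⟦ s ⟧ˢ * ⟦ e′ ⟧ˢ * (⟦ s ⟧ˢ * T L R)       ≈⟨ *-assoc _ _ _ ⟩
      ⟦ s ⟧ˢ * (⟦ e′ ⟧ˢ * (⟦ s ⟧ˢ * T L R))     ≈⟨ *-congˡ (*-x∙yz≈y∙xz _ _ _) ⟩
      ⟦ s ⟧ˢ * (⟦ s ⟧ˢ * (⟦ e′ ⟧ˢ * T L R))     ≈⟨ ⟦unit⟧-cancelˡ (sp-unit Z↭LR) _ ⟩
      ⟦ e′ ⟧ˢ * T L R                           ∎
      where
      Z↭LR = splits-sp Z t∈
      e′ = e (map f (L ++ R))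
      e-fZ : e (map f Z) ≡ s ·ˢ e′
      e-fZ = altˢ-sp₀ {e = e} alte (sp-map f Z↭LR)

  unsignedSplitSum : ∀ {A : Set} → (List A → List A → Carrier) → List A → Carrier
  unsignedSplitSum K = splitSum (λ L R _ → K L R)

  unsignedSplitSum-∷ : ∀ {A : Set} (K : List A → List A → Carrier) a Z →
    unsignedSplitSum K (a ∷ Z) ≈
      unsignedSplitSum (λ L R → K (a ∷ L) R) Z + unsignedSplitSum (λ L R → K L (a ∷ R)) Z
  unsignedSplitSum-∷ K = splitSum-∷ (λ L R _ → K L R)

  unsignedSplitSum-forceˡ : ∀ {A : Set} (K : List A → List A → Carrier) xs →
    (∀ {x} → x ∈ xs → ∀ L R → K L (x ∷ R) ≈ 0#) →
    ∀ Z → unsignedSplitSum K (xs ++ Z) ≈ unsignedSplitSum (λ L R → K (xs ++ L) R) Z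
  unsignedSplitSum-forceˡ K [] _ Z = ≈-refl
  unsignedSplitSum-forceˡ K (x ∷ xs) K≈0 Z = begin
    unsignedSplitSum K (x ∷ xs ++ Z)   ≈⟨ unsignedSplitSum-∷ K x (xs ++ Z) ⟩
    unsignedSplitSum (λ L R → K (x ∷ L) R) (xs ++ Z) + unsignedSplitSum (λ L R → K L (x ∷ R)) (xs ++ Z)
      ≈⟨ +-congˡ (splitSum-zero (λ L R _ → K≈0 (here refl) L R) (xs ++ Z)) ⟩
    unsignedSplitSum (λ L R → K (x ∷ L) R) (xs ++ Z) + 0#  ≈⟨ +-identityʳ _ ⟩
    unsignedSplitSum (λ L R → K (x ∷ L) R) (xs ++ Z)
      ≈⟨ unsignedSplitSum-forceˡ (λ L R → K (x ∷ L) R) xs (λ y∈xs L R → K≈0 (there y∈xs) (x ∷ L) R) Z ⟩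
    unsignedSplitSum (λ L R → K (x ∷ xs ++ L) R) Z ∎

  unsignedSplitSum-forceʳ : ∀ {A : Set} (K : List A → List A → Carrier) xs →
    (∀ {x} → x ∈ xs → ∀ L R → K (x ∷ L) R ≈ 0#) →
    ∀ Z → unsignedSplitSum K (xs ++ Z) ≈ unsignedSplitSum (λ L R → K L (xs ++ R)) Z
  unsignedSplitSum-forceʳ K [] _ Z = ≈-refl
  unsignedSplitSum-forceʳ K (x ∷ xs) K≈0 Z = begin
    unsignedSplitSum K (x ∷ xs ++ Z)   ≈⟨ unsignedSplitSum-∷ K x (xs ++ Z) ⟩
    unsignedSplitSum (λ L R → K (x ∷ L) R) (xs ++ Z) + unsignedSplitSum (λ L R → K L (x ∷ R)) (xs ++ Z)
      ≈⟨ +-congʳ (splitSum-zero (λ L R _ → K≈0 (here refl) L R) (xs ++ Z)) ⟩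
    0# + unsignedSplitSum (λ L R → K L (x ∷ R)) (xs ++ Z)  ≈⟨ +-identityˡ _ ⟩
    unsignedSplitSum (λ L R → K L (x ∷ R)) (xs ++ Z)
      ≈⟨ unsignedSplitSum-forceʳ (λ L R → K L (x ∷ R)) xs (λ y∈xs L R → K≈0 (there y∈xs) L (x ∷ R)) Z ⟩
    unsignedSplitSum (λ L R → K L (x ∷ xs ++ R)) Z ∎

  unsignedSplitSum-subsetsC : ∀ {A B : Set} (f : A → B) (K : List B → List B → Carrier) E →
    unsignedSplitSum K (map f E) ≈ sumK (map (λ (B , C) → K (map f B) (map f C)) (subsetsC E))
  unsignedSplitSum-subsetsC f K [] = ≈-refl
  unsignedSplitSum-subsetsC f K (e ∷ E) = begin
    unsignedSplitSum K (f e ∷ map f E)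
      ≈⟨ unsignedSplitSum-∷ K (f e) (map f E) ⟩
    unsignedSplitSum (λ L R → K (f e ∷ L) R) (map f E) + unsignedSplitSum (λ L R → K L (f e ∷ R)) (map f E)
      ≈⟨ +-cong (unsignedSplitSum-subsetsC f _ E) (unsignedSplitSum-subsetsC f _ E) ⟩
    sumK (map (λ (B , C) → K (f e ∷ map f B) (map f C)) (subsetsC E)) +
    sumK (map (λ (B , C) → K (map f B) (f e ∷ map f C)) (subsetsC E))
      ≈⟨ sumK-+ _ _ (subsetsC E) ⟨
    sumK (map (λ (B , C) → K (f e ∷ map f B) (map f C) + K (map f B) (f e ∷ map f C)) (subsetsC E))
      ≈⟨ sumK-cong (λ _ → +-congˡ (+-identityʳ _)) (subsetsC E) ⟨
    _ ≈⟨ sumK-concatMap _ _ (subsetsC E) ⟨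
    sumK (map (λ (B , C) → K (map f B) (map f C)) (subsetsC (e ∷ E))) ∎

  alt-square-↭ : ∀ {A : Set} {f : List A → Carrier} → Alternating f → ∀ {xs ys} → xs ↭ ys →
    f xs * f xs ≈ f ys * f ys
  alt-square-↭ {f = f} altf {xs} {ys} xs↭ys with ↭⇒sp xs↭ys
  ... | s , xs↭ys⟨s⟩ = begin
    f xs * f xs                          ≈⟨ *-cong (alt-sp₀ {f = f} altf xs↭ys⟨s⟩) (alt-sp₀ {f = f} altf xs↭ys⟨s⟩) ⟩
    ⟦ s ⟧ˢ * f ys * (⟦ s ⟧ˢ * f ys)      ≈⟨ *-assoc _ _ _ ⟩
    ⟦ s ⟧ˢ * (f ys * (⟦ s ⟧ˢ * f ys))    ≈⟨ *-congˡ (*-x∙yz≈y∙xz _ _ _) ⟩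
    ⟦ s ⟧ˢ * (⟦ s ⟧ˢ * (f ys * f ys))    ≈⟨ ⟦unit⟧-cancelˡ (sp-unit xs↭ys⟨s⟩) _ ⟩
    f ys * f ys                          ∎

  -- The coordinates of the image of N under the algebra homomorphism that sends each basis
  -- vector x to k·y when letter x ≡ just (y , k), and to 0 when letter x ≡ nothing.
  module InducedHomomorphism {A B : Set} (Φ : Ext A → Ext B) (letter : B → Maybe (A × Carrier))
    (Φ-[] : ∀ N → Φ N [] ≈ N [])
    (Φ-nothing : ∀ N x Z → letter x ≡ nothing → Φ N (x ∷ Z) ≈ 0#)
    (Φ-just : ∀ N x Z y k → letter x ≡ just (y , k) → Φ N (x ∷ Z) ≈ k * Φ (λ L → N (y ∷ L)) Z) where

    Φ-scale : ∀ {N N′ : Ext A} a → (∀ L → N′ L ≈ a * N L) → ∀ Z → Φ N′ Z ≈ a * Φ N Z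
    Φ-scale {N} {N′} a N′≈aN [] = ≈-trans (Φ-[] N′) (≈-trans (N′≈aN []) (*-congˡ (≈-sym (Φ-[] N))))
    Φ-scale {N} {N′} a N′≈aN (x ∷ Z) with letter x in eq
    ... | nothing = ≈-trans (Φ-nothing N′ x Z eq) (≈-sym (≈-trans (*-congˡ (Φ-nothing N x Z eq)) (zeroʳ a)))
    ... | just (y , k) = begin
      Φ N′ (x ∷ Z)                     ≈⟨ Φ-just N′ x Z y k eq ⟩
      k * Φ (λ L → N′ (y ∷ L)) Z        ≈⟨ *-congˡ (Φ-scale a (λ L → N′≈aN (y ∷ L)) Z) ⟩
      k * (a * Φ (λ L → N (y ∷ L)) Z)   ≈⟨ *-x∙yz≈y∙xz k a _ ⟩
      a * (k * Φ (λ L → N (y ∷ L)) Z)   ≈⟨ *-congˡ (Φ-just N x Z y k eq) ⟨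
      a * Φ N (x ∷ Z)                  ∎

    Φ-vanishes : ∀ N {x Z} → x ∈ Z → letter x ≡ nothing → Φ N Z ≈ 0#
    Φ-vanishes N {Z = x ∷ Z} (here refl) eq = Φ-nothing N x Z eq
    Φ-vanishes N {Z = z ∷ Z} (there x∈Z) eq with letter z in ez
    ... | nothing = Φ-nothing N z Z ez
    ... | just (y , k) =
      ≈-trans (Φ-just N z Z y k ez) (≈-trans (*-congˡ (Φ-vanishes (λ L → N (y ∷ L)) x∈Z eq)) (zeroʳ k))

    Φ-vanishes-neg : ∀ N {x Y Y′} → x ∈ Y → x ∈ Y′ → letter x ≡ nothing → Φ N Y ≈ - Φ N Y′
    Φ-vanishes-neg N x∈Y x∈Y′ ex = ≈-trans (Φ-vanishes N x∈Y ex)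
      (≈-trans (≈-sym -0#≈0#) (-‿cong (≈-sym (Φ-vanishes N x∈Y′ ex))))

    Φ-alternating : ∀ {N} → Alternating N → Alternating (Φ N)
    Φ-alternating {N} altN (c ∷ P) a b Q with letter c in ec
    ... | nothing = Φ-vanishes-neg N (here refl) (here refl) ec
    ... | just (y , k) = begin
      Φ N (c ∷ P ++ a ∷ b ∷ Q)                   ≈⟨ Φ-just N c _ y k ec ⟩
      k * Φ (λ L → N (y ∷ L)) (P ++ a ∷ b ∷ Q)    ≈⟨ *-congˡ (Φ-alternating (alt-prefix {f = N} altN [ y ]) P a b Q) ⟩
      k * - Φ (λ L → N (y ∷ L)) (P ++ b ∷ a ∷ Q)  ≈⟨ -‿distribʳ-* _ _ ⟨
      - (k * Φ (λ L → N (y ∷ L)) (P ++ b ∷ a ∷ Q)) ≈⟨ -‿cong (Φ-just N c _ y k ec) ⟨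
      - Φ N (c ∷ P ++ b ∷ a ∷ Q)                 ∎
    Φ-alternating {N} altN [] a b Q with letter a in ea | letter b in eb
    ... | nothing | _ = Φ-vanishes-neg N (here refl) (there (here refl)) ea
    ... | just _ | nothing = Φ-vanishes-neg N (there (here refl)) (here refl) eb
    ... | just (y , k) | just (y′ , k′) = begin
      Φ N (a ∷ b ∷ Q)                                 ≈⟨ Φ-just N a _ y k ea ⟩
      k * Φ (λ L → N (y ∷ L)) (b ∷ Q)                  ≈⟨ *-congˡ (Φ-just _ b Q y′ k′ eb) ⟩
      k * (k′ * Φ (λ L → N (y ∷ y′ ∷ L)) Q)
        ≈⟨ *-congˡ (*-congˡ (Φ-scale (- 1#) (λ L → ≈-trans (altN [] y y′ L) (≈-sym (-1*x≈-x _))) Q)) ⟩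
      k * (k′ * (- 1# * Φ (λ L → N (y′ ∷ y ∷ L)) Q))   ≈⟨ *-congˡ (*-x∙yz≈y∙xz _ _ _) ⟩
      k * (- 1# * (k′ * Φ (λ L → N (y′ ∷ y ∷ L)) Q))   ≈⟨ *-x∙yz≈y∙xz _ _ _ ⟩
      - 1# * (k * (k′ * Φ (λ L → N (y′ ∷ y ∷ L)) Q))   ≈⟨ -1*x≈-x _ ⟩
      - (k * (k′ * Φ (λ L → N (y′ ∷ y ∷ L)) Q))        ≈⟨ -‿cong (*-x∙yz≈y∙xz _ _ _) ⟩
      - (k′ * (k * Φ (λ L → N (y′ ∷ y ∷ L)) Q))        ≈⟨ -‿cong (*-congˡ (Φ-just _ a Q y k ea)) ⟨
      - (k′ * Φ (λ L → N (y′ ∷ L)) (a ∷ Q))            ≈⟨ -‿cong (Φ-just N b _ y′ k′ eb) ⟨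
      - Φ N (b ∷ a ∷ Q)                               ∎

    Φ-map : ∀ {X : Set} (f : X → B) (fy : X → A) (fk : X → Carrier) →
      (∀ x → letter (f x) ≡ just (fy x , fk x)) →
      ∀ (Bs : List X) Z (N : Ext A) → Φ N (map f Bs ++ Z) ≈ prodK (map fk Bs) * Φ (λ L → N (map fy Bs ++ L)) Z
    Φ-map f fy fk letter-f [] Z N = ≈-sym (*-identityˡ _)
    Φ-map f fy fk letter-f (x ∷ Bs) Z N = begin
      Φ N (f x ∷ map f Bs ++ Z)
        ≈⟨ Φ-just N (f x) _ (fy x) (fk x) (letter-f x) ⟩
      fk x * Φ (λ L → N (fy x ∷ L)) (map f Bs ++ Z)
        ≈⟨ *-congˡ (Φ-map f fy fk letter-f Bs Z _) ⟩
      fk x * (prodK (map fk Bs) * Φ (λ L → N (fy x ∷ map fy Bs ++ L)) Z)  ≈⟨ *-assoc _ _ _ ⟨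
      prodK (map fk (x ∷ Bs)) * Φ (λ L → N (map fy (x ∷ Bs) ++ L)) Z       ∎

    Φ-map₀ : ∀ {X : Set} (f : X → B) (fy : X → A) (fk : X → Carrier) →
      (∀ x → letter (f x) ≡ just (fy x , fk x)) →
      ∀ (Bs : List X) (N : Ext A) → Φ N (map f Bs) ≈ prodK (map fk Bs) * N (map fy Bs)
    Φ-map₀ f fy fk letter-f Bs N = begin
      Φ N (map f Bs)                              ≡⟨ cong (Φ N) (++-identityʳ (map f Bs)) ⟨
      Φ N (map f Bs ++ [])                        ≈⟨ Φ-map f fy fk letter-f Bs [] N ⟩
      prodK (map fk Bs) * Φ (λ L → N (map fy Bs ++ L)) [] ≈⟨ *-congˡ (Φ-[] _) ⟩
      prodK (map fk Bs) * N (map fy Bs ++ [])     ≡⟨ cong (λ X → _ * N X) (++-identityʳ (map fy Bs)) ⟩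
      prodK (map fk Bs) * N (map fy Bs)           ∎

  oneE-alternating : ∀ {S : Set} → Alternating (oneE {S})
  oneE-alternating [] a b Q = ≈-sym -0#≈0#
  oneE-alternating (x ∷ P) a b Q = ≈-sym -0#≈0#

  vecE-alternating : ∀ {S : Set} (v : S → Carrier) → Alternating (vecE v)
  vecE-alternating v [] a b Q = ≈-sym -0#≈0#
  vecE-alternating v (x ∷ []) a b Q = ≈-sym -0#≈0#
  vecE-alternating v (x ∷ y ∷ P) a b Q = ≈-sym -0#≈0#

  IsExtensor⇒Alternating : ∀ {S : Set} {N : Ext S} → IsExtensor N → Alternating N
  IsExtensor⇒Alternating (k , vs , N≈k∧vs) =
    alt-scale {f = foldr _∧E_ oneE (map vecE vs)} (∧vecE-alternating vs) k N≈k∧vs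
    where
    ∧vecE-alternating : ∀ vs → Alternating (foldr _∧E_ oneE (map vecE vs))
    ∧vecE-alternating [] = oneE-alternating
    ∧vecE-alternating (v ∷ vs) = ∧E-alternating (vecE-alternating v) (∧vecE-alternating vs)

  module _ {p m : ℕ} where

    ιLetter υLetter : (Fin m → Carrier) → Port p m → Maybe (G p m × Carrier)
    ιLetter g (ι i) = just (inj₁ i , 1#)
    ιLetter g (υ i) = nothing
    ιLetter g (el e) = just (inj₂ e , g e)
    υLetter r (ι i) = nothing
    υLetter r (υ i) = just (inj₁ i , 1#)
    υLetter r (el e) = just (inj₂ e , r e)

    private
      ιmap-nothing : ∀ g N x Z → ιLetter g x ≡ nothing → ιmap g N (x ∷ Z) ≈ 0#
      ιmap-nothing g N (υ i) Z _ = ≈-refl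

      ιmap-just : ∀ g N x Z y k → ιLetter g x ≡ just (y , k) → ιmap g N (x ∷ Z) ≈ k * ιmap g (λ L → N (y ∷ L)) Z
      ιmap-just g N (ι i) Z _ _ refl with preι g Z
      ... | just _ = ≈-sym (*-identityˡ _)
      ... | nothing = ≈-sym (zeroʳ _)
      ιmap-just g N (el e) Z _ _ refl with preι g Z
      ... | just _ = *-assoc _ _ _
      ... | nothing = ≈-sym (zeroʳ _)

      υmap-nothing : ∀ r N x Z → υLetter r x ≡ nothing → υmap r N (x ∷ Z) ≈ 0#
      υmap-nothing r N (ι i) Z _ = ≈-refl

      υmap-just : ∀ r N x Z y k → υLetter r x ≡ just (y , k) → υmap r N (x ∷ Z) ≈ k * υmap r (λ L → N (y ∷ L)) Z
      υmap-just r N (υ i) Z _ _ refl with preυ r Z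
      ... | just _ = ≈-sym (*-identityˡ _)
      ... | nothing = ≈-sym (zeroʳ _)
      υmap-just r N (el e) Z _ _ refl with preυ r Z
      ... | just _ = *-assoc _ _ _
      ... | nothing = ≈-sym (zeroʳ _)

    module ιmap (g : Fin m → Carrier) =
      InducedHomomorphism (ιmap g) (ιLetter g) (λ N → *-identityˡ _) (ιmap-nothing g) (ιmap-just g)
    module υmap (r : Fin m → Carrier) =
      InducedHomomorphism (υmap r) (υLetter r) (λ N → *-identityˡ _) (υmap-nothing r) (υmap-just r)

    dual-alternating : ∀ (ε : List (G p m) → Sgn) → Alternatingˢ ε → ∀ N → Alternating (dual ε N)
    dual-alternating ε altε N P a b Q = begin
      N (compl X) * ⟦ ε (compl X ++ X) ⟧ˢ
        ≡⟨ cong (λ C → N C * ⟦ ε (C ++ X) ⟧ˢ) (compl-resp-↭ (↭ₚ.++⁺ˡ P (↭.swap a b ↭.refl))) ⟩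
      N C′ * ⟦ ε (C′ ++ X) ⟧ˢ              ≡⟨ cong (λ s → N C′ * ⟦ s ⟧ˢ) swapped ⟩
      N C′ * ⟦ negˢ (ε (C′ ++ X′)) ⟧ˢ      ≈⟨ *-congˡ (⟦negˢ⟧ (ε (C′ ++ X′))) ⟩
      N C′ * - ⟦ ε (C′ ++ X′) ⟧ˢ           ≈⟨ -‿distribʳ-* _ _ ⟨
      - (N C′ * ⟦ ε (C′ ++ X′) ⟧ˢ)         ∎
      where
      X = P ++ a ∷ b ∷ Q
      X′ = P ++ b ∷ a ∷ Q
      C′ = compl X′
      swapped : ε (C′ ++ X) ≡ negˢ (ε (C′ ++ X′))
      swapped = trans (cong ε (sym (++-assoc C′ P (a ∷ b ∷ Q))))
        (trans (altε (C′ ++ P) a b Q) (cong (negˢ ∘ ε) (++-assoc C′ P (b ∷ a ∷ Q))))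

    M-alternating : ∀ ε → Alternatingˢ ε → ∀ g r {N} → Alternating N → Alternating (M ε g r N)
    M-alternating ε altε g r {N} altN =
      ∧E-alternating (ιmap.Φ-alternating g altN) (υmap.Φ-alternating r (dual-alternating ε altε N))

    M-negE : ∀ ε g r N A → M ε g r (negE N) A ≈ M ε g r N A
    M-negE ε g r N A = begin
      M ε g r (negE N) A          ≈⟨ ∧E-scale (- 1#) (- 1#) ι-neg υ-neg A ⟩
      (- 1# * - 1#) * M ε g r N A ≈⟨ *-congʳ (⟦unit⟧² neg-unit) ⟩
      1# * M ε g r N A            ≈⟨ *-identityˡ _ ⟩
      M ε g r N A                 ∎
      where
      ι-neg : ∀ L → ιmap g (negE N) L ≈ - 1# * ιmap g N L
      ι-neg = ιmap.Φ-scale g (- 1#) (λ L → ≈-sym (-1*x≈-x _))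
      υ-neg : ∀ R → υmap r (dual ε (negE N)) R ≈ - 1# * υmap r (dual ε N) R
      υ-neg = υmap.Φ-scale r (- 1#) (λ X → ≈-trans (≈-sym (-‿distribˡ-* _ _)) (≈-sym (-1*x≈-x _)))

    M-rescale-orientation : ∀ ε ε′ g r N k → (∀ X → ⟦ ε′ (compl X ++ X) ⟧ˢ ≈ k * ⟦ ε (compl X ++ X) ⟧ˢ) →
      ∀ A → M ε′ g r N A ≈ k * M ε g r N A
    M-rescale-orientation ε ε′ g r N k ε′≈kε A = begin
      M ε′ g r N A        ≈⟨ ∧E-scale 1# k (λ L → ≈-sym (*-identityˡ _))
                               (υmap.Φ-scale r k (λ X → ≈-trans (*-congˡ (ε′≈kε X)) (*-x∙yz≈y∙xz _ _ _))) A ⟩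
      (1# * k) * M ε g r N A ≈⟨ *-congʳ (*-identityˡ k) ⟩
      k * M ε g r N A     ∎

    M-negˢ∘ε : ∀ ε g r N A → M (negˢ ∘ ε) g r N A ≈ - M ε g r N A
    M-negˢ∘ε ε g r N A = ≈-trans
      (M-rescale-orientation ε (negˢ ∘ ε) g r N (- 1#)
        (λ X → ≈-trans (⟦negˢ⟧ (ε (compl X ++ X))) (≈-sym (-1*x≈-x _))) A)
      (-1*x≈-x _)

    prodK-1# : ∀ {X : Set} (xs : List X) → prodK (map (λ _ → 1#) xs) ≈ 1#
    prodK-1# [] = ≈-refl
    prodK-1# (x ∷ xs) = ≈-trans (*-congˡ (prodK-1# xs)) (*-identityˡ 1#)

    ιmap-ports : ∀ g N Ps B → ιmap g N (map ι Ps ++ map el B) ≈ prodK (map g B) * N (Pseq Ps ++ Eseq B)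
    ιmap-ports g N Ps B = begin
      ιmap g N (map ι Ps ++ map el B)
        ≈⟨ ιmap.Φ-map g ι inj₁ (λ _ → 1#) (λ _ → refl) Ps (map el B) N ⟩
      prodK (map (λ _ → 1#) Ps) * ιmap g (λ L → N (Pseq Ps ++ L)) (map el B)
        ≈⟨ *-cong (prodK-1# Ps) (ιmap.Φ-map₀ g el inj₂ g (λ _ → refl) B _) ⟩
      1# * (prodK (map g B) * N (Pseq Ps ++ Eseq B))
        ≈⟨ *-identityˡ _ ⟩
      prodK (map g B) * N (Pseq Ps ++ Eseq B) ∎

    υmap-ports : ∀ r N Ps C → υmap r N (map υ Ps ++ map el C) ≈ prodK (map r C) * N (Pseq Ps ++ Eseq C)
    υmap-ports r N Ps C = begin
      υmap r N (map υ Ps ++ map el C)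
        ≈⟨ υmap.Φ-map r υ inj₁ (λ _ → 1#) (λ _ → refl) Ps (map el C) N ⟩
      prodK (map (λ _ → 1#) Ps) * υmap r (λ L → N (Pseq Ps ++ L)) (map el C)
        ≈⟨ *-cong (prodK-1# Ps) (υmap.Φ-map₀ r el inj₂ r (λ _ → refl) C _) ⟩
      1# * (prodK (map r C) * N (Pseq Ps ++ Eseq C))
        ≈⟨ *-identityˡ _ ⟩
      prodK (map r C) * N (Pseq Ps ++ Eseq C) ∎

  module Corollary {p m : ℕ} (O : Orientation (G p m)) (g r : Fin m → Carrier) {N : Ext (G p m)}
                   (altN : Alternating N) where
    open Orientation O using (ε)

    private
      altε : Alternatingˢ ε
      altε = ε-alternating O

      alt⟦ε⟧ : Alternating (λ X → ⟦ ε X ⟧ˢ)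
      alt⟦ε⟧ = ⟦⟧-alternating {e = ε} altε

      altM : Alternating (M ε g r N)
      altM = M-alternating ε altε g r altN

      allFin-length : ∀ {Q : List (Fin p ⊎ Fin p)} → length Q ≡ p → length (Pseq {p} {m} (allFin p)) ≡ length Q
      allFin-length |Q|≡p = trans (length-map inj₁ (allFin p)) (trans (length-tabulate id) (sym |Q|≡p))

    MEQ-negE : ∀ Es Q → MEQ ε g r Es (negE N) Q ≈ MEQ ε g r Es N Q
    MEQ-negE Es Q = M-negE ε g r N (map toPort Q ++ map el Es)

    MEQ-negˢ∘ε : ∀ Es Q → MEQ (negˢ ∘ ε) g r Es N Q ≈ - MEQ ε g r Es N Q
    MEQ-negˢ∘ε Es Q = M-negˢ∘ε ε g r N (map toPort Q ++ map el Es)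

    MEQ-alternatingE : ∀ Q → Alternating (λ Es → MEQ ε g r Es N Q)
    MEQ-alternatingE Q =
      alt-map {f = λ X → M ε g r N (map toPort Q ++ X)} (alt-prefix {f = M ε g r N} altM (map toPort Q)) el

    MEQ-alternatingQ : ∀ Es → Alternating (λ Q → MEQ ε g r Es N Q)
    MEQ-alternatingQ Es =
      alt-map {f = λ X → M ε g r N (X ++ map el Es)} (alt-suffix {f = M ε g r N} altM (map el Es)) toPort

    MEQ-permuteE : ∀ {Es} → Unique Es → ∀ Q (σ : Permutation′ (length Es)) →
      MEQ ε g r (permute Es σ) N Q ≈ ⟦ sgnPerm σ ⟧ˢ * MEQ ε g r Es N Q
    MEQ-permuteE {Es} uEs Q = alt-permute O (map⁺ inj₂-injective uEs) {f = λ Es → MEQ ε g r Es N Q}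
      (MEQ-alternatingE Q) Es (length-map inj₂ Es)

    MEQ-permuteQ : ∀ Es Q → length Q ≡ p → (σ : Permutation′ (length Q)) →
      MEQ ε g r Es N (permute Q σ) ≈ ⟦ sgnPerm σ ⟧ˢ * MEQ ε g r Es N Q
    MEQ-permuteQ Es Q |Q|≡p = alt-permute O (map⁺ inj₁-injective (allFin⁺ p)) {f = λ Q → MEQ ε g r Es N Q}
      (MEQ-alternatingQ Es) Q (allFin-length {Q} |Q|≡p)

    WEQ-negE : ∀ Ps Es Q → WEQ ε g r Ps Es (negE N) Q ≈ WEQ ε g r Ps Es N Q
    WEQ-negE Ps Es Q = *-congˡ (MEQ-negE Es Q)

    WEQ-permuteE : ∀ Ps Es Q (σ : Permutation′ (length Es)) →
      WEQ ε g r Ps (permute Es σ) N Q ≈ WEQ ε g r Ps Es N Q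
    WEQ-permuteE Ps Es Q = alt-*-permute {f = λ Es → ⟦ ε (Pseq Ps ++ Eseq Es) ⟧ˢ} {h = λ Es → MEQ ε g r Es N Q}
      (alt-map {f = λ X → ⟦ ε (Pseq Ps ++ X) ⟧ˢ} (alt-prefix {f = λ X → ⟦ ε X ⟧ˢ} alt⟦ε⟧ (Pseq Ps)) inj₂)
      (MEQ-alternatingE Q) Es

    WEQ-permuteP : ∀ {Ps} → Unique Ps → ∀ Es Q (σ : Permutation′ (length Ps)) →
      WEQ ε g r (permute Ps σ) Es N Q ≈ ⟦ sgnPerm σ ⟧ˢ * WEQ ε g r Ps Es N Q
    WEQ-permuteP {Ps} uPs Es Q σ = ≈-trans
      (*-congʳ (alt-permute O (map⁺ inj₁-injective uPs) {f = λ Ps → ⟦ ε (Pseq Ps ++ Eseq Es) ⟧ˢ}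
        (alt-map {f = λ X → ⟦ ε (X ++ Eseq Es) ⟧ˢ} (alt-suffix {f = λ X → ⟦ ε X ⟧ˢ} alt⟦ε⟧ (Eseq Es)) inj₁)
        Ps (length-map inj₁ Ps) σ))
      (*-assoc _ _ _)

    WEQ-permuteQ : ∀ Ps Es Q → length Q ≡ p → (σ : Permutation′ (length Q)) →
      WEQ ε g r Ps Es N (permute Q σ) ≈ ⟦ sgnPerm σ ⟧ˢ * WEQ ε g r Ps Es N Q
    WEQ-permuteQ Ps Es Q |Q|≡p σ = ≈-trans (*-congˡ (MEQ-permuteQ Es Q |Q|≡p σ)) (*-x∙yz≈y∙xz _ _ _)

    WEQ-orientation : ∀ {Ps Es} → Enumerates (Pseq Ps ++ Eseq Es) → ∀ (O′ : Orientation (G p m)) Q →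
      WEQ (Orientation.ε O′) g r Ps Es N Q ≈ WEQ ε g r Ps Es N Q
    WEQ-orientation {Ps} {Es} enum@(uZ , _) O′ Q = begin
      ⟦ ε′ Z ⟧ˢ * M ε′ g r N A             ≈⟨ *-congˡ (M-rescale-orientation ε ε′ g r N ⟦ k ⟧ˢ ε′≈kε A) ⟩
      ⟦ ε′ Z ⟧ˢ * (⟦ k ⟧ˢ * M ε g r N A)   ≈⟨ *-assoc _ _ _ ⟨
      ⟦ ε′ Z ⟧ˢ * ⟦ k ⟧ˢ * M ε g r N A     ≈⟨ *-congʳ (⟦·ˢ⟧ (ε′ Z) k) ⟨
      ⟦ ε′ Z ·ˢ k ⟧ˢ * M ε g r N A         ≡⟨ cong (λ s → ⟦ s ⟧ˢ * M ε g r N A) (unit-cancelˡ (ε-unit O′ uZ) (ε Z)) ⟩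
      ⟦ ε Z ⟧ˢ * M ε g r N A               ∎
      where
      ε′ = Orientation.ε O′
      Z = Pseq Ps ++ Eseq Es
      A = map toPort Q ++ map el Es
      k = ε′ Z ·ˢ ε Z
      ε′≈kε : ∀ X → ⟦ ε′ (compl X ++ X) ⟧ˢ ≈ ⟦ k ⟧ˢ * ⟦ ε (compl X ++ X) ⟧ˢ
      ε′≈kε X = ≈-trans
        (≈-reflexive (cong ⟦_⟧ˢ (orientations-proportional _≟G_ O O′ enum (compl X ++ X) (compl++-complete X))))
        (⟦·ˢ⟧ k _)

    dual-complement : ∀ {X X′} → Enumerates (X ++ X′) → dual ε N X′ ≈ ⟦ ε (X ++ X′) ⟧ˢ * N X
    dual-complement {X} {X′} enum with ↭⇒sp (compl-↭ enum)
    ... | t , X̄′↭X = begin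
      N (compl X′) * ⟦ ε (compl X′ ++ X′) ⟧ˢ       ≈⟨ *-cong (alt-sp₀ {f = N} altN X̄′↭X) ε-X̄′X′ ⟩
      ⟦ t ⟧ˢ * N X * (⟦ t ⟧ˢ * ⟦ ε (X ++ X′) ⟧ˢ)   ≈⟨ *-interchange _ _ _ _ ⟩
      ⟦ t ⟧ˢ * ⟦ t ⟧ˢ * (N X * ⟦ ε (X ++ X′) ⟧ˢ)   ≈⟨ *-congʳ (⟦unit⟧² (sp-unit X̄′↭X)) ⟩
      1# * (N X * ⟦ ε (X ++ X′) ⟧ˢ)                ≈⟨ *-identityˡ _ ⟩
      N X * ⟦ ε (X ++ X′) ⟧ˢ                       ≈⟨ *-comm _ _ ⟩
      ⟦ ε (X ++ X′) ⟧ˢ * N X                       ∎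
      where
      ε-X̄′X′ : ⟦ ε (compl X′ ++ X′) ⟧ˢ ≈ ⟦ t ⟧ˢ * ⟦ ε (X ++ X′) ⟧ˢ
      ε-X̄′X′ = ≈-trans (≈-reflexive (cong ⟦_⟧ˢ (altˢ-spʳ {e = ε} altε X̄′↭X X′))) (⟦·ˢ⟧ t _)

    splitting-term : ∀ {X X′} → Enumerates (X ++ X′) → ∀ a b →
      ⟦ ε (X ++ X′) ⟧ˢ * ((a * N X) * (b * dual ε N X′)) ≈ (a * b) * (N X * N X)
    splitting-term {X} {X′} enum a b = begin
      e * ((a * N X) * (b * dual ε N X′))   ≈⟨ *-congˡ (*-congˡ (*-congˡ (dual-complement enum))) ⟩
      e * ((a * N X) * (b * (e * N X)))     ≈⟨ *-congˡ (*-interchange _ _ _ _) ⟩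
      e * ((a * b) * (N X * (e * N X)))     ≈⟨ *-congˡ (*-congˡ (*-x∙yz≈y∙xz _ _ _)) ⟩
      e * ((a * b) * (e * (N X * N X)))     ≈⟨ *-congˡ (*-x∙yz≈y∙xz _ _ _) ⟩
      e * (e * ((a * b) * (N X * N X)))     ≈⟨ ⟦unit⟧-cancelˡ (ε-unit O (proj₁ enum)) _ ⟩
      (a * b) * (N X * N X)                 ∎
      where e = ⟦ ε (X ++ X′) ⟧ˢ

    private
      ground : Port p m → G p m
      ground (ι i) = inj₁ i
      ground (υ i) = inj₁ i
      ground (el e) = inj₂ e

      ground-ι : ∀ Ps B → map ground (map ι Ps ++ map el B) ≡ Pseq Ps ++ Eseq B
      ground-ι Ps B = trans (map-++ ground (map ι Ps) (map el B)) (cong₂ _++_ (sym (map-∘ Ps)) (sym (map-∘ B)))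

      ground-υ : ∀ Ps C → map ground (map υ Ps ++ map el C) ≡ Pseq Ps ++ Eseq C
      ground-υ Ps C = trans (map-++ ground (map υ Ps) (map el C)) (cong₂ _++_ (sym (map-∘ Ps)) (sym (map-∘ C)))

      term : List (Port p m) → List (Port p m) → Carrier
      term L R = ⟦ ε (map ground (L ++ R)) ⟧ˢ * (ιmap g N L * υmap r (dual ε N) R)

      ε-M≈unsignedSplitSum : ∀ A → ⟦ ε (map ground A) ⟧ˢ * M ε g r N A ≈ unsignedSplitSum term A
      ε-M≈unsignedSplitSum A =
        ≈-trans (*-congˡ (∧E≈signedSplitSum _ _ A)) (signedSplitSum-absorb {e = ε} altε ground _ A)

      Eseq-subsetsC-↭ : ∀ {Es B C} → (B , C) ∈ subsetsC Es → Eseq {p} {m} B ++ Eseq C ↭ Eseq Es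
      Eseq-subsetsC-↭ {Es} {B} {C} BC∈ =
        ↭.trans (↭.↭-reflexive (sym (map-++ inj₂ B C))) (↭ₚ.map⁺ inj₂ (subsetsC-↭ Es BC∈))

    WEQ-ι : ∀ {Ps Es} → IsOrdering Ps → IsOrdering Es → WEQ ε g r Ps Es N (map inj₁ Ps) ≈ rhsIndep g r Ps Es N
    WEQ-ι {Ps} {Es} oP oE = begin
      ⟦ ε (Pseq Ps ++ Eseq Es) ⟧ˢ * M ε g r N (map toPort (map inj₁ Ps) ++ map el Es)
        ≡⟨ cong₂ (λ Z X → ⟦ ε Z ⟧ˢ * M ε g r N (X ++ map el Es)) (sym (ground-ι Ps Es)) (sym (map-∘ Ps)) ⟩
      ⟦ ε (map ground A) ⟧ˢ * M ε g r N A
        ≈⟨ ε-M≈unsignedSplitSum A ⟩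
      unsignedSplitSum term A
        ≈⟨ unsignedSplitSum-forceˡ term (map ι Ps) υmap-ι (map el Es) ⟩
      unsignedSplitSum (λ L R → term (map ι Ps ++ L) R) (map el Es)
        ≈⟨ unsignedSplitSum-subsetsC el _ Es ⟩
      sumK (map (λ (B , C) → term (map ι Ps ++ map el B) (map el C)) (subsetsC Es))
        ≈⟨ sumK-cong∈ (subsetsC Es) (λ _ → subset-term) ⟩
      rhsIndep g r Ps Es N ∎
      where
      A = map ι Ps ++ map el Es
      υmap-ι : ∀ {x} → x ∈ map ι Ps → ∀ L R → term L (x ∷ R) ≈ 0#
      υmap-ι x∈ L R with ∈-map⁻ ι x∈
      ... | _ , _ , refl = ≈-trans (*-congˡ (zeroʳ _)) (zeroʳ _)
      subset-term : ∀ {B C} → (B , C) ∈ subsetsC Es →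
        term (map ι Ps ++ map el B) (map el C) ≈ (prodK (map g B) * prodK (map r C)) * (N (Eseq B ++ Pseq Ps)) ²
      subset-term {B} {C} BC∈ = begin
        term (map ι Ps ++ map el B) (map el C)
          ≡⟨ cong (λ X → ⟦ ε X ⟧ˢ * _)
               (trans (map-++ ground (map ι Ps ++ map el B) (map el C)) (cong₂ _++_ (ground-ι Ps B) (ground-ι [] C))) ⟩
        ⟦ ε (PB ++ Eseq C) ⟧ˢ * (ιmap g N (map ι Ps ++ map el B) * υmap r (dual ε N) (map el C))
          ≈⟨ *-congˡ (*-cong (ιmap-ports g N Ps B) (υmap-ports r (dual ε N) [] C)) ⟩
        ⟦ ε (PB ++ Eseq C) ⟧ˢ * ((prodK (map g B) * N PB) * (prodK (map r C) * dual ε N (Eseq C)))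
          ≈⟨ splitting-term (enumerates-resp-↭ (↭-sym PB++C↭PE) (Pseq++Eseq-enumerates oP oE)) _ _ ⟩
        (prodK (map g B) * prodK (map r C)) * (N PB * N PB)
          ≈⟨ *-congˡ (alt-square-↭ {f = N} altN (↭ₚ.++-comm (Pseq Ps) (Eseq B))) ⟩
        (prodK (map g B) * prodK (map r C)) * (N (Eseq B ++ Pseq Ps)) ² ∎
        where
        PB = Pseq Ps ++ Eseq B
        PB++C↭PE : PB ++ Eseq C ↭ Pseq Ps ++ Eseq Es
        PB++C↭PE = ↭.trans (↭.↭-reflexive (++-assoc (Pseq Ps) (Eseq B) (Eseq C)))
                            (↭ₚ.++⁺ˡ (Pseq Ps) (Eseq-subsetsC-↭ BC∈))

    WEQ-υ : ∀ {Ps Es} → IsOrdering Ps → IsOrdering Es → WEQ ε g r Ps Es N (map inj₂ Ps) ≈ rhsCoindep g r Es N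
    WEQ-υ {Ps} {Es} oP oE = begin
      ⟦ ε (Pseq Ps ++ Eseq Es) ⟧ˢ * M ε g r N (map toPort (map inj₂ Ps) ++ map el Es)
        ≡⟨ cong₂ (λ Z X → ⟦ ε Z ⟧ˢ * M ε g r N (X ++ map el Es)) (sym (ground-υ Ps Es)) (sym (map-∘ Ps)) ⟩
      ⟦ ε (map ground A) ⟧ˢ * M ε g r N A
        ≈⟨ ε-M≈unsignedSplitSum A ⟩
      unsignedSplitSum term A
        ≈⟨ unsignedSplitSum-forceʳ term (map υ Ps) ιmap-υ (map el Es) ⟩
      unsignedSplitSum (λ L R → term L (map υ Ps ++ R)) (map el Es)
        ≈⟨ unsignedSplitSum-subsetsC el _ Es ⟩
      sumK (map (λ (B , C) → term (map el B) (map υ Ps ++ map el C)) (subsetsC Es))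
        ≈⟨ sumK-cong∈ (subsetsC Es) (λ _ → subset-term) ⟩
      rhsCoindep g r Es N ∎
      where
      A = map υ Ps ++ map el Es
      ιmap-υ : ∀ {x} → x ∈ map υ Ps → ∀ L R → term (x ∷ L) R ≈ 0#
      ιmap-υ x∈ L R with ∈-map⁻ υ x∈
      ... | _ , _ , refl = ≈-trans (*-congˡ (zeroˡ _)) (zeroʳ _)
      subset-term : ∀ {B C} → (B , C) ∈ subsetsC Es →
        term (map el B) (map υ Ps ++ map el C) ≈ (prodK (map g B) * prodK (map r C)) * (N (Eseq B)) ²
      subset-term {B} {C} BC∈ = begin
        term (map el B) (map υ Ps ++ map el C)
          ≡⟨ cong (λ X → ⟦ ε X ⟧ˢ * _)
               (trans (map-++ ground (map el B) (map υ Ps ++ map el C)) (cong₂ _++_ (ground-ι [] B) (ground-υ Ps C))) ⟩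
        ⟦ ε (Eseq B ++ PC) ⟧ˢ * (ιmap g N (map el B) * υmap r (dual ε N) (map υ Ps ++ map el C))
          ≈⟨ *-congˡ (*-cong (ιmap-ports g N [] B) (υmap-ports r (dual ε N) Ps C)) ⟩
        ⟦ ε (Eseq B ++ PC) ⟧ˢ * ((prodK (map g B) * N (Eseq B)) * (prodK (map r C) * dual ε N PC))
          ≈⟨ splitting-term (enumerates-resp-↭ (↭-sym B++PC↭PE) (Pseq++Eseq-enumerates oP oE)) _ _ ⟩
        (prodK (map g B) * prodK (map r C)) * (N (Eseq B)) ² ∎
        where
        PC = Pseq Ps ++ Eseq C
        B++PC↭PE : Eseq B ++ PC ↭ Pseq Ps ++ Eseq Es
        B++PC↭PE = ↭.trans (↭ₚ.shifts (Eseq B) (Pseq Ps)) (↭ₚ.++⁺ˡ (Pseq Ps) (Eseq-subsetsC-↭ BC∈))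

corollary23 : ∀ {c ℓ} (F : Field c ℓ) → let open ExtAlg₂ F in
    (p m : ℕ) (g r : Fin m → Carrier)
    (N : Ext (G p m)) → IsExtensor N →
    (O : Orientation (G p m)) →
    (Ps : List (Fin p)) → IsOrdering Ps →
    (Es : List (Fin m)) → IsOrdering Es →
    let ε = Orientation.ε O in
    -- (1)
    (∀ (Q : List (Fin p ⊎ Fin p)) → Unique Q → length Q ≡ p →
      (MEQ ε g r Es (negE N) Q ≈ MEQ ε g r Es N Q)
      × (∀ σ → MEQ ε g r (permute Es σ) N Q ≈ ⟦ sgnPerm σ ⟧ˢ * MEQ ε g r Es N Q)
      × (MEQ (negˢ ∘ ε) g r Es N Q ≈ - MEQ ε g r Es N Q)
      × (∀ σ → MEQ ε g r Es N (permute Q σ) ≈ ⟦ sgnPerm σ ⟧ˢ * MEQ ε g r Es N Q))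
    -- (2)
    × (∀ (Q : List (Fin p ⊎ Fin p)) → Unique Q → length Q ≡ p →
      (WEQ ε g r Ps Es (negE N) Q ≈ WEQ ε g r Ps Es N Q)
      × (∀ (O′ : Orientation (G p m)) → WEQ (Orientation.ε O′) g r Ps Es N Q ≈ WEQ ε g r Ps Es N Q)
      × (∀ σ → WEQ ε g r Ps (permute Es σ) N Q ≈ WEQ ε g r Ps Es N Q)
      × (∀ σ → WEQ ε g r (permute Ps σ) Es N Q ≈ ⟦ sgnPerm σ ⟧ˢ * WEQ ε g r Ps Es N Q)
      × (∀ σ → WEQ ε g r Ps Es N (permute Q σ) ≈ ⟦ sgnPerm σ ⟧ˢ * WEQ ε g r Ps Es N Q))
    -- (3)
    × (Independent N (Pseq Ps) → WEQ ε g r Ps Es N (map inj₁ Ps) ≈ rhsIndep g r Ps Es N)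
    -- (4)
    × (Coindependent N (Pseq Ps) → WEQ ε g r Ps Es N (map inj₂ Ps) ≈ rhsCoindep g r Es N)
corollary23 F p m g r N isExtensor O Ps oP Es oE =
  (λ Q _ |Q|≡p →
      MEQ-negE Es Q , MEQ-permuteE (proj₁ oE) Q , MEQ-negˢ∘ε Es Q , MEQ-permuteQ Es Q |Q|≡p) ,
  (λ Q _ |Q|≡p →
      WEQ-negE Ps Es Q , (λ O′ → WEQ-orientation (Pseq++Eseq-enumerates oP oE) O′ Q) ,
      WEQ-permuteE Ps Es Q , WEQ-permuteP (proj₁ oP) Es Q , WEQ-permuteQ Ps Es Q |Q|≡p) ,
  (λ _ → WEQ-ι oP oE) ,
  (λ _ → WEQ-υ oP oE)
  where
  open WithField F
  open Corollary O g r {N} (IsExtensor⇒Alternating isExtensor)
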